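{- Let $u,v\in\mathbb{YF}_n$ and define $X_u^v\in\mathbb Q$ by $p_u=\sum_{v\in\mathbb{YF}_n}X_u^vs_v$. Let $\delta_1<\delta_2<\dots<\delta_m$ be the positions of the 2's in $u$, put $\delta_{m+1}=\infty$, and let $d_1,\dots,d_r$ be the positions of the 2's in $v$. Then $$X_u^v=\prod_{s:\,d_s<\delta_1}d_s\cdot\prod_{j=1}^m\ \prod_{s:\,\delta_j\le d_s<\delta_{j+1}}\bigl(d_s-(\delta_j+1)\bigr),$$ where $\delta_1=\infty$ if $m=0$. Equivalently, $X_u^v=d(v)\prod_{j=1}^m\prod_{s:\delta_j\le d_s<\delta_{j+1}}\bigl(1-\frac{\delta_j+1}{d_s}\bigr)$, where $d(v)=\prod_{s=1}^r d_s$.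
   Context: Fibonacci words: finite words in $\{1,2\}$; rank $|v|$ = sum of digits; $\mathbb{YF}_n$ = words of rank $n$. If $v=v_12v_2$, the position of the indicated 2 is $|v_2|+1$. $R=\mathbb Q\langle X,Y\rangle$ graded by $\deg X=1,\deg Y=2$, with degree-$n$ part $R_n$. Noncommutative determinant: $\det(a_{ij})=\sum_{\sigma\in S_n}\mathrm{sgn}(\sigma)a_{\sigma(1)1}a_{\sigma(2)2}\cdots a_{\sigma(n)n}$. $P_n$ ($n\ge0$, $P_0=1$) is the $n\times n$ determinant of the tridiagonal matrix with $X$ on the diagonal, $Y$ on the superdiagonal and $1$ on the subdiagonal; for $n\ge1$, $Q_{n-1}$ is the $n\times n$ determinant of the matrix obtained from that of $P_n$ by replacing the first row by $(Y,Y,0,\dots,0)$ and the second row by $(X,X,Y,0,\dots,0)$ ($Q_0=Y$). For $v=1^{k_t}21^{k_{t-1}}2\cdots1^{k_1}21^{k_0}$ ($k_i\ge0$): $s_v=P_{k_0}Q_{k_1}\cdots Q_{k_t}$ and $p_v=(X^{k_0+2}-(k_0+2)X^{k_0}Y)\cdots(X^{k_{t-1}+2}-(k_{t-1}+2)X^{k_{t-1}}Y)X^{k_t}$. Both families indexed by $\mathbb{YF}_n$ are bases of $R_n$. -}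

module Defs where

open import Data.Nat as ℕ using (ℕ; zero; suc; _<ᵇ_; _≤ᵇ_; _≡ᵇ_)
open import Data.Integer using (+_)
open import Data.Rational using (ℚ; 0ℚ; 1ℚ; _/_) renaming (_+_ to _+ℚ_; _*_ to _*ℚ_; _-_ to _-ℚ_; -_ to -ℚ_)
open import Data.Bool using (Bool; true; false; if_then_else_; _∧_; not)
open import Data.List using (List; []; _∷_; _++_; map; filter; foldr; concatMap; reverse; length)
open import Data.Product using (_×_; _,_)
open import Data.Fin using (Fin; toℕ)
open import Data.Vec using (Vec; []; _∷_; lookup; allFin; toList)
open import Relation.Binary.PropositionalEquality using (_≡_)

-- The free algebra R = ℚ⟨X,Y⟩ : finite formal ℚ-linear combinations of
-- words in the letters X, Y, compared coefficientwise.

data Letter : Set where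
  𝕏 𝕐 : Letter

eqLetter : Letter → Letter → Bool
eqLetter 𝕏 𝕏 = true
eqLetter 𝕐 𝕐 = true
eqLetter _ _ = false

Mono : Set
Mono = List Letter

eqMono : Mono → Mono → Bool
eqMono [] [] = true
eqMono (a ∷ w) (b ∷ w') = eqLetter a b ∧ eqMono w w'
eqMono _ _ = false

Poly : Set
Poly = List (ℚ × Mono)

coeff : Poly → Mono → ℚ
coeff [] w = 0ℚ
coeff ((c , m) ∷ p) w = (if eqMono m w then c else 0ℚ) +ℚ coeff p w

_≈_ : Poly → Poly → Set
p ≈ q = ∀ (w : Mono) → coeff p w ≡ coeff q w

infix 4 _≈_
infixl 6 _⊕_ _⊖_
infixl 7 _⊗_ _·_

𝟘 𝟙 X Y : Poly
𝟘 = []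
𝟙 = (1ℚ , []) ∷ []
X = (1ℚ , 𝕏 ∷ []) ∷ []
Y = (1ℚ , 𝕐 ∷ []) ∷ []

_⊕_ : Poly → Poly → Poly
p ⊕ q = p ++ q

_·_ : ℚ → Poly → Poly
c · p = map (λ { (a , m) → (c *ℚ a , m) }) p

_⊖_ : Poly → Poly → Poly
p ⊖ q = p ⊕ (-ℚ 1ℚ) · q

_⊗_ : Poly → Poly → Poly
p ⊗ q = concatMap (λ { (a , m) → map (λ { (b , n) → (a *ℚ b , m ++ n) }) q }) p

sumP : List Poly → Poly
sumP = foldr _⊕_ 𝟘

prodP : List Poly → Poly
prodP = foldr _⊗_ 𝟙

_^_ : Poly → ℕ → Poly
p ^ zero = 𝟙
p ^ suc n = p ⊗ (p ^ n)

ℕtoℚ : ℕ → ℚ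
ℕtoℚ n = + n / 1

-- Noncommutative determinant
--   det(a_ij) = Σ_{σ ∈ S_n} sgn(σ) a_{σ(1)1} a_{σ(2)2} ⋯ a_{σ(n)n}
-- Permutations of Fin n are enumerated as the injective sequences
-- (σ(0),…,σ(n-1)) among all sequences in Fin n; sgn σ = (-1)^{#inversions}.

allSeqs : (n k : ℕ) → List (Vec (Fin n) k)
allSeqs n zero = [] ∷ []
allSeqs n (suc k) =
  concatMap (λ i → map (λ s → i ∷ s) (allSeqs n k)) (toList (allFin n))

pairsL : {A : Set} → List A → List (A × A)
pairsL [] = []
pairsL (a ∷ as) = map (λ b → (a , b)) as ++ pairsL as

isPerm : {n : ℕ} → Vec (Fin n) n → Bool
isPerm σ = foldr (λ { (a , b) r → not (toℕ a ≡ᵇ toℕ b) ∧ r }) true (pairsL (toList σ))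

inversions : {n : ℕ} → Vec (Fin n) n → ℕ
inversions σ = length (filter (λ { (a , b) → toℕ b ℕ.<? toℕ a }) (pairsL (toList σ)))

sgn : ℕ → ℚ
sgn zero = 1ℚ
sgn (suc k) = -ℚ (sgn k)

permutations : (n : ℕ) → List (Vec (Fin n) n)
permutations n = filter (λ σ → Data.Bool.T? (isPerm σ)) (allSeqs n n)
  where import Data.Bool

det : (n : ℕ) → (Fin n → Fin n → Poly) → Poly
det n a = sumP (map (λ σ → sgn (inversions σ) ·
                     prodP (map (λ j → a (lookup σ j) j) (toList (allFin n))))
               (permutations n))

tri : ℕ → ℕ → Poly
tri i j = if i ≡ᵇ j then X else
          if suc i ≡ᵇ j then Y else
          if i ≡ᵇ suc j then 𝟙 else 𝟘

P : ℕ → Poly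
P n = det n (λ i j → tri (toℕ i) (toℕ j))

qEntry : ℕ → ℕ → Poly
qEntry zero zero = Y
qEntry zero (suc zero) = Y
qEntry zero (suc (suc _)) = 𝟘
qEntry (suc zero) zero = X
qEntry (suc zero) (suc zero) = X
qEntry (suc zero) (suc (suc zero)) = Y
qEntry (suc zero) (suc (suc (suc _))) = 𝟘
qEntry i j = tri i j

-- Q_{n-1} is the n×n determinant, i.e. Q k is (k+1)×(k+1)
Q : ℕ → Poly
Q k = det (suc k) (λ i j → qEntry (toℕ i) (toℕ j))

data Digit : Set where
  d1 d2 : Digit

FWord : Set
FWord = List Digit

rank : FWord → ℕ
rank [] = 0
rank (d1 ∷ w) = suc (rank w)
rank (d2 ∷ w) = suc (suc (rank w))

YF : ℕ → List FWord
YF zero = [] ∷ []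
YF (suc zero) = (d1 ∷ []) ∷ []
YF (suc (suc n)) = map (d1 ∷_) (YF (suc n)) ++ map (d2 ∷_) (YF n)

-- v = 1^{k_t} 2 1^{k_{t-1}} 2 ⋯ 1^{k_1} 2 1^{k_0}  ↦  [k_t, …, k_1, k_0]
blocks : FWord → List ℕ
blocks [] = 0 ∷ []
blocks (d2 ∷ w) = 0 ∷ blocks w
blocks (d1 ∷ w) with blocks w
... | [] = 1 ∷ []
... | k ∷ ks = suc k ∷ ks

s : FWord → Poly
s v with reverse (blocks v)
... | [] = 𝟙
... | k₀ ∷ ks = P k₀ ⊗ prodP (map Q ks)

pfac : ℕ → Poly
pfac k = X ^ (suc (suc k)) ⊖ ℕtoℚ (suc (suc k)) · (X ^ k ⊗ Y)

p : FWord → Poly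
p v with blocks v
... | [] = 𝟙
... | kₜ ∷ ks = prodP (map pfac (reverse ks)) ⊗ X ^ kₜ

-- positions of the 2's: for v = v₁ 2 v₂ the position is |v₂| + 1.
-- Listed left to right, i.e. in decreasing order.
positionsDesc : FWord → List ℕ
positionsDesc [] = []
positionsDesc (d1 ∷ w) = positionsDesc w
positionsDesc (d2 ∷ w) = suc (rank w) ∷ positionsDesc w

positions : FWord → List ℕ
positions w = reverse (positionsDesc w)

prodQ : List ℚ → ℚ
prodQ = foldr _*ℚ_ 1ℚ

belowFirst : List ℕ → ℕ → Bool
belowFirst [] d = true
belowFirst (δ ∷ _) d = d <ᵇ δ

intervalProd : List ℕ → List ℕ → ℚ
intervalProd [] ds = 1ℚ
intervalProd (δ ∷ rest) ds =
  prodQ (map (λ d → ℕtoℚ d -ℚ ℕtoℚ (suc δ))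
             (filter (λ d → Data.Bool.T? ((δ ≤ᵇ d) ∧ belowFirst rest d)) ds))
  *ℚ intervalProd rest ds
  where import Data.Bool

coeffFormula : FWord → FWord → ℚ
coeffFormula u v =
  prodQ (map ℕtoℚ (filter (λ d → Data.Bool.T? (belowFirst δs d)) ds))
  *ℚ intervalProd δs ds
  where
    import Data.Bool
    δs = positions u
    ds = positions v

{-# OPTIONS --safe #-}
module Submission where

-- Laplace expansion along the first column gives the continuant recurrences
-- P (k+2) = X P (k+1) − Y P k and Q k = Y P k − X Y P (k−1), hence the right-handed
-- recurrences P (k+2) = P (k+1) X − P k Y and Q (k+2) = Q (k+1) X − Q k Y, so that
-- s (11v) = s (1v) X − s v Y, s (12v) = s (2v) X − s v X Y and s (2v) = s v Y.
-- From these, X^m = ∑_{|v| = m} d(v) s v, and more generally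
-- (X^{k+2} − (k+2) X^k Y) s w = ∑_{|z| = k+2} g(z) s (wz) with g(1z) = d(z), g(2z) = −d(z).
-- Since p (u 2 1^k) = (X^{k+2} − (k+2) X^k Y) p u, induction on u expresses p u in the
-- basis s; splitting the words of rank |u| + k + 2 as vz with |z| = k + 2, or as v2z with
-- |z| = k + 1, the claimed coefficients factor as X_u^v g(z) in the first case and
-- vanish in the second (the 2 at position k + 2 = δ₁ + 1 contributes the factor 0).

open import Defs
open import Data.Bool using (Bool; true; false; if_then_else_; _∧_; not; T)
open import Data.Bool.Properties using (∧-assoc; ∧-identityʳ)
open import Data.Empty using (⊥-elim)
open import Data.Unit using (tt)
open import Data.Fin as Fin using (Fin; zero; suc; toℕ; punchIn; punchOut; #_)
open import Data.Fin.Properties using (punchIn-punchOut)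
import Data.Integer as ℤ
import Data.Integer.Properties as ℤP
open import Data.List as List
  using (List; []; _∷_; _++_; map; foldr; concatMap; filter; filterᵇ; length; reverse; replicate)
open import Data.List.Properties
  using (map-++; ++-assoc; ++-identityʳ; map-cong; map-∘; foldr-++; length-++; filter-++;
         unfold-reverse; reverse-++; reverse-map)
open import Data.List.Relation.Unary.All as All using (All; []; _∷_)
import Data.List.Relation.Unary.All.Properties as AllP
open import Data.Nat as ℕ using (ℕ; zero; suc; _+_; _<_; _≤_; z≤n; s≤s; _<ᵇ_; _≤ᵇ_; _≡ᵇ_)
import Data.Nat.Properties as ℕP
import Data.Nat.Solver as ℕSolver
open import Data.Product using (_×_; _,_; proj₁; proj₂)
open import Data.Rational using (ℚ; 0ℚ; 1ℚ)
  renaming (_+_ to _+q_; _*_ to _*q_; -_ to -q_; _-_ to _-q_)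
import Data.Rational.Properties as ℚP
open import Data.Rational.Solver
open +-*-Solver
  using (solve; _:=_; Polynomial; op; con; var; _:^_; :-_; _:+_; _:*_; ⟦_⟧; ⟦_⟧↓; correct; [+]; [*])
import Data.Rational.Unnormalised as ℚᵘ
import Data.Rational.Unnormalised.Properties as ℚᵘP
open import Data.Vec as Vec using (Vec; []; _∷_; lookup; allFin; toList)
open import Data.Vec.Properties using (lookup-++ˡ; lookup-++ʳ; lookup-map; toList-map; allFin-map)
open import Level using (0ℓ)
open import Relation.Binary.Bundles using (Setoid)
import Relation.Binary.Reasoning.Setoid as SetoidReasoning
open import Relation.Binary.PropositionalEquality
open import Relation.Nullary using (does; yes; no)
open import Relation.Unary using (Pred; Decidable)

-- The free algebra ℚ⟨X,Y⟩

indicator : Bool → ℚ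
indicator true = 1ℚ
indicator false = 0ℚ

if-indicator : ∀ b c → (if b then c else 0ℚ) ≡ indicator b *q c
if-indicator true c = sym (ℚP.*-identityˡ c)
if-indicator false c = sym (ℚP.*-zeroˡ c)

∑ℚ : {A : Set} → (A → ℚ) → List A → ℚ
∑ℚ f [] = 0ℚ
∑ℚ f (x ∷ xs) = f x +q ∑ℚ f xs

module _ {A : Set} where

  ∑ℚ-cong : {f g : A → ℚ} → (∀ x → f x ≡ g x) → ∀ xs → ∑ℚ f xs ≡ ∑ℚ g xs
  ∑ℚ-cong e [] = refl
  ∑ℚ-cong e (x ∷ xs) = cong₂ _+q_ (e x) (∑ℚ-cong e xs)

  ∑ℚ-zero : (xs : List A) → ∑ℚ (λ _ → 0ℚ) xs ≡ 0ℚ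
  ∑ℚ-zero [] = refl
  ∑ℚ-zero (x ∷ xs) = trans (ℚP.+-identityˡ _) (∑ℚ-zero xs)

  ∑ℚ-zeroˡ : (g : A → ℚ) (xs : List A) → ∑ℚ (λ x → 0ℚ *q g x) xs ≡ 0ℚ
  ∑ℚ-zeroˡ g xs = trans (∑ℚ-cong (λ x → ℚP.*-zeroˡ (g x)) xs) (∑ℚ-zero xs)

  ∑ℚ-+ : (f g : A → ℚ) (xs : List A) → ∑ℚ (λ x → f x +q g x) xs ≡ ∑ℚ f xs +q ∑ℚ g xs
  ∑ℚ-+ f g [] = sym (ℚP.+-identityˡ 0ℚ)
  ∑ℚ-+ f g (x ∷ xs) = trans (cong ((f x +q g x) +q_) (∑ℚ-+ f g xs))
    (solve 4 (λ a b c d → (a :+ b) :+ (c :+ d) := (a :+ c) :+ (b :+ d)) refl (f x) (g x) (∑ℚ f xs) (∑ℚ g xs))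

  ∑ℚ-*ʳ : (f : A → ℚ) (c : ℚ) (xs : List A) → ∑ℚ (λ x → f x *q c) xs ≡ ∑ℚ f xs *q c
  ∑ℚ-*ʳ f c [] = sym (ℚP.*-zeroˡ c)
  ∑ℚ-*ʳ f c (x ∷ xs) = trans (cong ((f x *q c) +q_) (∑ℚ-*ʳ f c xs)) (sym (ℚP.*-distribʳ-+ c (f x) (∑ℚ f xs)))

  ∑ℚ-*ˡ : (c : ℚ) (f : A → ℚ) (xs : List A) → ∑ℚ (λ x → c *q f x) xs ≡ c *q ∑ℚ f xs
  ∑ℚ-*ˡ c f [] = sym (ℚP.*-zeroʳ c)
  ∑ℚ-*ˡ c f (x ∷ xs) = trans (cong ((c *q f x) +q_) (∑ℚ-*ˡ c f xs)) (sym (ℚP.*-distribˡ-+ c (f x) (∑ℚ f xs)))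

∑ℚ-map : {A B : Set} (f : B → ℚ) (g : A → B) (xs : List A) → ∑ℚ f (map g xs) ≡ ∑ℚ (λ x → f (g x)) xs
∑ℚ-map f g [] = refl
∑ℚ-map f g (x ∷ xs) = cong (f (g x) +q_) (∑ℚ-map f g xs)

coeff-++ : ∀ p q w → coeff (p ++ q) w ≡ coeff p w +q coeff q w
coeff-++ [] q w = sym (ℚP.+-identityˡ _)
coeff-++ ((c , m) ∷ p) q w =
  trans (cong ((if eqMono m w then c else 0ℚ) +q_) (coeff-++ p q w))
        (sym (ℚP.+-assoc (if eqMono m w then c else 0ℚ) (coeff p w) (coeff q w)))

coeff-· : ∀ c p w → coeff (c · p) w ≡ c *q coeff p w
coeff-· c [] w = sym (ℚP.*-zeroʳ c)
coeff-· c ((a , m) ∷ p) w = begin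
  (if eqMono m w then c *q a else 0ℚ) +q coeff (c · p) w
    ≡⟨ cong₂ _+q_ (if-indicator (eqMono m w) (c *q a)) (coeff-· c p w) ⟩
  indicator (eqMono m w) *q (c *q a) +q c *q coeff p w
    ≡⟨ solve 4 (λ i c a r → i :* (c :* a) :+ c :* r := c :* (i :* a :+ r)) refl (indicator (eqMono m w)) c a (coeff p w) ⟩
  c *q (indicator (eqMono m w) *q a +q coeff p w)
    ≡⟨ cong (λ z → c *q (z +q coeff p w)) (sym (if-indicator (eqMono m w) a)) ⟩
  c *q coeff ((a , m) ∷ p) w ∎
  where open ≡-Reasoning

splittings : Mono → List (Mono × Mono)
splittings [] = ([] , []) ∷ []
splittings (x ∷ w) = ([] , x ∷ w) ∷ map (λ s → (x ∷ proj₁ s , proj₂ s)) (splittings w)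

convolution : (Mono → ℚ) → (Mono → ℚ) → Mono → ℚ
convolution f g w = ∑ℚ (λ s → f (proj₁ s) *q g (proj₂ s)) (splittings w)

indicator-++ : ∀ m n w →
  indicator (eqMono (m ++ n) w) ≡ convolution (λ w₁ → indicator (eqMono m w₁)) (λ w₂ → indicator (eqMono n w₂)) w
indicator-++ [] n [] = solve 1 (λ x → x := con 1ℚ :* x :+ con 0ℚ) refl (indicator (eqMono n []))
indicator-++ [] n (x ∷ w) = begin
  indicator (eqMono n (x ∷ w))
    ≡⟨ solve 1 (λ y → y := con 1ℚ :* y :+ con 0ℚ) refl (indicator (eqMono n (x ∷ w))) ⟩
  1ℚ *q indicator (eqMono n (x ∷ w)) +q 0ℚ
    ≡⟨ cong (1ℚ *q indicator (eqMono n (x ∷ w)) +q_)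
            (sym (trans (∑ℚ-map _ (λ s → (x ∷ proj₁ s , proj₂ s)) (splittings w))
                        (∑ℚ-zeroˡ (λ s → indicator (eqMono n (proj₂ s))) (splittings w)))) ⟩
  convolution (λ w₁ → indicator (eqMono [] w₁)) (λ w₂ → indicator (eqMono n w₂)) (x ∷ w) ∎
  where open ≡-Reasoning
indicator-++ (y ∷ m) n [] = sym (solve 1 (λ x → con 0ℚ :* x :+ con 0ℚ := con 0ℚ) refl (indicator (eqMono n [])))
indicator-++ (y ∷ m) n (x ∷ w) =
  trans (head-letter (eqLetter y x))
        (cong (0ℚ *q indicator (eqMono n (x ∷ w)) +q_) (sym (∑ℚ-map _ (λ s → (x ∷ proj₁ s , proj₂ s)) (splittings w))))
  where
  open ≡-Reasoning
  head-letter : ∀ b → indicator (b ∧ eqMono (m ++ n) w) ≡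
    0ℚ *q indicator (eqMono n (x ∷ w)) +q ∑ℚ (λ s → indicator (b ∧ eqMono m (proj₁ s)) *q indicator (eqMono n (proj₂ s))) (splittings w)
  head-letter true = begin
    indicator (eqMono (m ++ n) w)
      ≡⟨ indicator-++ m n w ⟩
    convolution (λ w₁ → indicator (eqMono m w₁)) (λ w₂ → indicator (eqMono n w₂)) w
      ≡⟨ solve 2 (λ a c → c := con 0ℚ :* a :+ c) refl (indicator (eqMono n (x ∷ w))) _ ⟩
    _ ∎
  head-letter false = begin
    0ℚ
      ≡⟨ sym (solve 1 (λ a → con 0ℚ :* a :+ con 0ℚ := con 0ℚ) refl (indicator (eqMono n (x ∷ w)))) ⟩
    0ℚ *q indicator (eqMono n (x ∷ w)) +q 0ℚ
      ≡⟨ cong (0ℚ *q indicator (eqMono n (x ∷ w)) +q_) (sym (∑ℚ-zeroˡ (λ s → indicator (eqMono n (proj₂ s))) (splittings w))) ⟩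
    _ ∎

coeff-map-prefix : ∀ {f : ℚ × Mono → ℚ × Mono} a m → (∀ b n → f (b , n) ≡ (a *q b , m ++ n)) → ∀ q w →
  coeff (map f q) w ≡ convolution (λ w₁ → indicator (eqMono m w₁) *q a) (coeff q) w
coeff-map-prefix a m hf [] w =
  sym (trans (∑ℚ-cong (λ s → ℚP.*-zeroʳ (indicator (eqMono m (proj₁ s)) *q a)) (splittings w)) (∑ℚ-zero (splittings w)))
coeff-map-prefix {f} a m hf ((b , n) ∷ q) w rewrite hf b n = begin
  (if eqMono (m ++ n) w then a *q b else 0ℚ) +q coeff (map f q) w
    ≡⟨ cong₂ _+q_ (if-indicator (eqMono (m ++ n) w) (a *q b)) (coeff-map-prefix a m hf q w) ⟩
  indicator (eqMono (m ++ n) w) *q (a *q b) +q ∑ℚ G (splittings w)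
    ≡⟨ cong (λ z → z *q (a *q b) +q ∑ℚ G (splittings w)) (indicator-++ m n w) ⟩
  ∑ℚ (λ s → indicator (eqMono m (proj₁ s)) *q indicator (eqMono n (proj₂ s))) (splittings w) *q (a *q b) +q ∑ℚ G (splittings w)
    ≡⟨ cong (_+q ∑ℚ G (splittings w)) (sym (∑ℚ-*ʳ _ (a *q b) (splittings w))) ⟩
  ∑ℚ F (splittings w) +q ∑ℚ G (splittings w)
    ≡⟨ sym (∑ℚ-+ F G (splittings w)) ⟩
  ∑ℚ (λ s → F s +q G s) (splittings w)
    ≡⟨ ∑ℚ-cong (λ s → regroup (indicator (eqMono m (proj₁ s))) (proj₂ s)) (splittings w) ⟩
  convolution (λ w₁ → indicator (eqMono m w₁) *q a) (coeff ((b , n) ∷ q)) w ∎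
  where
  open ≡-Reasoning
  F G : Mono × Mono → ℚ
  F s = indicator (eqMono m (proj₁ s)) *q indicator (eqMono n (proj₂ s)) *q (a *q b)
  G s = indicator (eqMono m (proj₁ s)) *q a *q coeff q (proj₂ s)
  regroup : ∀ i w₂ → i *q indicator (eqMono n w₂) *q (a *q b) +q i *q a *q coeff q w₂ ≡ i *q a *q coeff ((b , n) ∷ q) w₂
  regroup i w₂ = begin
    i *q indicator (eqMono n w₂) *q (a *q b) +q i *q a *q coeff q w₂
      ≡⟨ solve 5 (λ i j a b r → i :* j :* (a :* b) :+ i :* a :* r := i :* a :* (j :* b :+ r)) refl i (indicator (eqMono n w₂)) a b (coeff q w₂) ⟩
    i *q a *q (indicator (eqMono n w₂) *q b +q coeff q w₂)
      ≡⟨ cong (λ z → i *q a *q (z +q coeff q w₂)) (sym (if-indicator (eqMono n w₂) b)) ⟩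
    i *q a *q coeff ((b , n) ∷ q) w₂ ∎

coeff-⊗ : ∀ p q w → coeff (p ⊗ q) w ≡ convolution (coeff p) (coeff q) w
coeff-⊗ [] q w = sym (∑ℚ-zeroˡ (λ s → coeff q (proj₂ s)) (splittings w))
coeff-⊗ ((a , m) ∷ p) q w = begin
  coeff (map _ q ++ (p ⊗ q)) w
    ≡⟨ coeff-++ (map _ q) (p ⊗ q) w ⟩
  coeff (map _ q) w +q coeff (p ⊗ q) w
    ≡⟨ cong₂ _+q_ (coeff-map-prefix a m (λ b n → refl) q w) (coeff-⊗ p q w) ⟩
  ∑ℚ F (splittings w) +q ∑ℚ G (splittings w)
    ≡⟨ sym (∑ℚ-+ F G (splittings w)) ⟩
  ∑ℚ (λ s → F s +q G s) (splittings w)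
    ≡⟨ ∑ℚ-cong (λ s → regroup (proj₁ s) (proj₂ s)) (splittings w) ⟩
  convolution (coeff ((a , m) ∷ p)) (coeff q) w ∎
  where
  open ≡-Reasoning
  F G : Mono × Mono → ℚ
  F s = indicator (eqMono m (proj₁ s)) *q a *q coeff q (proj₂ s)
  G s = coeff p (proj₁ s) *q coeff q (proj₂ s)
  regroup : ∀ w₁ w₂ → indicator (eqMono m w₁) *q a *q coeff q w₂ +q coeff p w₁ *q coeff q w₂ ≡ coeff ((a , m) ∷ p) w₁ *q coeff q w₂
  regroup w₁ w₂ = begin
    indicator (eqMono m w₁) *q a *q coeff q w₂ +q coeff p w₁ *q coeff q w₂
      ≡⟨ sym (ℚP.*-distribʳ-+ (coeff q w₂) (indicator (eqMono m w₁) *q a) (coeff p w₁)) ⟩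
    (indicator (eqMono m w₁) *q a +q coeff p w₁) *q coeff q w₂
      ≡⟨ cong (λ z → (z +q coeff p w₁) *q coeff q w₂) (sym (if-indicator (eqMono m w₁) a)) ⟩
    coeff ((a , m) ∷ p) w₁ *q coeff q w₂ ∎

coeff-𝟙 : ∀ w → coeff 𝟙 w ≡ indicator (eqMono [] w)
coeff-𝟙 w = trans (ℚP.+-identityʳ (if eqMono [] w then 1ℚ else 0ℚ))
                  (trans (if-indicator (eqMono [] w) 1ℚ) (ℚP.*-identityʳ (indicator (eqMono [] w))))

convolution-unitˡ : ∀ (f : Mono → ℚ) w → convolution (λ w₁ → indicator (eqMono [] w₁)) f w ≡ f w
convolution-unitˡ f [] = solve 1 (λ x → con 1ℚ :* x :+ con 0ℚ := x) refl (f [])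
convolution-unitˡ f (x ∷ w) = begin
  1ℚ *q f (x ∷ w) +q ∑ℚ _ (map (λ s → (x ∷ proj₁ s , proj₂ s)) (splittings w))
    ≡⟨ cong (1ℚ *q f (x ∷ w) +q_) (trans (∑ℚ-map _ (λ s → (x ∷ proj₁ s , proj₂ s)) (splittings w))
                                         (∑ℚ-zeroˡ (λ s → f (proj₂ s)) (splittings w))) ⟩
  1ℚ *q f (x ∷ w) +q 0ℚ
    ≡⟨ solve 1 (λ y → con 1ℚ :* y :+ con 0ℚ := y) refl (f (x ∷ w)) ⟩
  f (x ∷ w) ∎
  where open ≡-Reasoning

convolution-unitʳ : ∀ (f : Mono → ℚ) w → convolution f (λ w₂ → indicator (eqMono [] w₂)) w ≡ f w
convolution-unitʳ f [] = solve 1 (λ x → x :* con 1ℚ :+ con 0ℚ := x) refl (f [])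
convolution-unitʳ f (x ∷ w) = begin
  f [] *q 0ℚ +q ∑ℚ _ (map (λ s → (x ∷ proj₁ s , proj₂ s)) (splittings w))
    ≡⟨ cong (f [] *q 0ℚ +q_) (trans (∑ℚ-map _ (λ s → (x ∷ proj₁ s , proj₂ s)) (splittings w))
                                   (convolution-unitʳ (λ m → f (x ∷ m)) w)) ⟩
  f [] *q 0ℚ +q f (x ∷ w)
    ≡⟨ solve 2 (λ a y → a :* con 0ℚ :+ y := y) refl (f []) (f (x ∷ w)) ⟩
  f (x ∷ w) ∎
  where open ≡-Reasoning

-- Wrapping _≈_ in a record makes the two polynomials recoverable from a proof, so that
-- they can be left implicit in the congruence lemmas below.
infix 4 _≋_
record _≋_ (p q : Poly) : Set where
  constructor mk≋
  field un≋ : p ≈ q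
open _≋_ public

≋-refl : ∀ {p} → p ≋ p
≋-refl = mk≋ (λ w → refl)

≋-sym : ∀ {p q} → p ≋ q → q ≋ p
≋-sym (mk≋ e) = mk≋ (λ w → sym (e w))

≋-trans : ∀ {p q r} → p ≋ q → q ≋ r → p ≋ r
≋-trans (mk≋ e) (mk≋ f) = mk≋ (λ w → trans (e w) (f w))

≡⇒≋ : ∀ {p q} → p ≡ q → p ≋ q
≡⇒≋ refl = ≋-refl

≋-setoid : Setoid 0ℓ 0ℓ
≋-setoid = record
  { Carrier = Poly ; _≈_ = _≋_
  ; isEquivalence = record { refl = ≋-refl ; sym = ≋-sym ; trans = ≋-trans } }

module ≋-Reasoning = SetoidReasoning ≋-setoid

⊕-cong : ∀ {p p′ q q′} → p ≋ p′ → q ≋ q′ → p ⊕ q ≋ p′ ⊕ q′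
⊕-cong {p} {p′} {q} {q′} (mk≋ e) (mk≋ f) =
  mk≋ λ w → trans (coeff-++ p q w) (trans (cong₂ _+q_ (e w) (f w)) (sym (coeff-++ p′ q′ w)))

⊕-congˡ : ∀ {p p′} q → p ≋ p′ → p ⊕ q ≋ p′ ⊕ q
⊕-congˡ q e = ⊕-cong e (≋-refl {q})

⊕-congʳ : ∀ p {q q′} → q ≋ q′ → p ⊕ q ≋ p ⊕ q′
⊕-congʳ p e = ⊕-cong (≋-refl {p}) e

⊕-comm : ∀ p q → p ⊕ q ≋ q ⊕ p
⊕-comm p q = mk≋ λ w → trans (coeff-++ p q w) (trans (ℚP.+-comm (coeff p w) (coeff q w)) (sym (coeff-++ q p w)))

⊕-assoc : ∀ p q r → (p ⊕ q) ⊕ r ≋ p ⊕ (q ⊕ r)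
⊕-assoc p q r = ≡⇒≋ (++-assoc p q r)

⊕-identityʳ : ∀ p → p ⊕ 𝟘 ≋ p
⊕-identityʳ p = mk≋ λ w → trans (coeff-++ p 𝟘 w) (ℚP.+-identityʳ (coeff p w))

⊕-interchange : ∀ a b c d → (a ⊕ b) ⊕ (c ⊕ d) ≋ (a ⊕ c) ⊕ (b ⊕ d)
⊕-interchange a b c d = begin
  (a ⊕ b) ⊕ (c ⊕ d) ≈⟨ ⊕-assoc a b (c ⊕ d) ⟩
  a ⊕ (b ⊕ (c ⊕ d)) ≈⟨ ⊕-congʳ a (≋-sym (⊕-assoc b c d)) ⟩
  a ⊕ ((b ⊕ c) ⊕ d) ≈⟨ ⊕-congʳ a (⊕-congˡ d (⊕-comm b c)) ⟩
  a ⊕ ((c ⊕ b) ⊕ d) ≈⟨ ⊕-congʳ a (⊕-assoc c b d) ⟩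
  a ⊕ (c ⊕ (b ⊕ d)) ≈⟨ ≋-sym (⊕-assoc a c (b ⊕ d)) ⟩
  (a ⊕ c) ⊕ (b ⊕ d) ∎
  where open ≋-Reasoning

·-cong : ∀ c {p q} → p ≋ q → c · p ≋ c · q
·-cong c {p} {q} (mk≋ e) = mk≋ λ w → trans (coeff-· c p w) (trans (cong (c *q_) (e w)) (sym (coeff-· c q w)))

·-distrib-⊕ : ∀ c p q → c · (p ⊕ q) ≋ c · p ⊕ c · q
·-distrib-⊕ c p q = ≡⇒≋ (map-++ _ p q)

·-assoc : ∀ c d p → c · (d · p) ≋ (c *q d) · p
·-assoc c d p = mk≋ λ w →
  trans (coeff-· c (d · p) w)
        (trans (cong (c *q_) (coeff-· d p w)) (trans (sym (ℚP.*-assoc c d (coeff p w))) (sym (coeff-· (c *q d) p w))))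

·-identity : ∀ p → 1ℚ · p ≋ p
·-identity p = mk≋ λ w → trans (coeff-· 1ℚ p w) (ℚP.*-identityˡ (coeff p w))

·-zero : ∀ p → 0ℚ · p ≋ 𝟘
·-zero p = mk≋ λ w → trans (coeff-· 0ℚ p w) (ℚP.*-zeroˡ (coeff p w))

⊗-cong : ∀ {p p′ q q′} → p ≋ p′ → q ≋ q′ → p ⊗ q ≋ p′ ⊗ q′
⊗-cong {p} {p′} {q} {q′} (mk≋ e) (mk≋ f) =
  mk≋ λ w → trans (coeff-⊗ p q w)
                  (trans (∑ℚ-cong (λ s → cong₂ _*q_ (e (proj₁ s)) (f (proj₂ s))) (splittings w)) (sym (coeff-⊗ p′ q′ w)))

⊗-congˡ : ∀ {p p′} q → p ≋ p′ → p ⊗ q ≋ p′ ⊗ q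
⊗-congˡ q e = ⊗-cong e (≋-refl {q})

⊗-congʳ : ∀ p {q q′} → q ≋ q′ → p ⊗ q ≋ p ⊗ q′
⊗-congʳ p e = ⊗-cong (≋-refl {p}) e

⊗-distribˡ : ∀ p q r → p ⊗ (q ⊕ r) ≋ p ⊗ q ⊕ p ⊗ r
⊗-distribˡ p q r = mk≋ λ w → begin
  coeff (p ⊗ (q ⊕ r)) w
    ≡⟨ coeff-⊗ p (q ⊕ r) w ⟩
  convolution (coeff p) (coeff (q ⊕ r)) w
    ≡⟨ ∑ℚ-cong (λ s → trans (cong (coeff p (proj₁ s) *q_) (coeff-++ q r (proj₂ s)))
                            (ℚP.*-distribˡ-+ (coeff p (proj₁ s)) (coeff q (proj₂ s)) (coeff r (proj₂ s)))) (splittings w) ⟩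
  ∑ℚ (λ s → coeff p (proj₁ s) *q coeff q (proj₂ s) +q coeff p (proj₁ s) *q coeff r (proj₂ s)) (splittings w)
    ≡⟨ ∑ℚ-+ _ _ (splittings w) ⟩
  convolution (coeff p) (coeff q) w +q convolution (coeff p) (coeff r) w
    ≡⟨ sym (trans (coeff-++ (p ⊗ q) (p ⊗ r) w) (cong₂ _+q_ (coeff-⊗ p q w) (coeff-⊗ p r w))) ⟩
  coeff (p ⊗ q ⊕ p ⊗ r) w ∎
  where open ≡-Reasoning

⊗-distribʳ : ∀ p q r → (p ⊕ q) ⊗ r ≋ p ⊗ r ⊕ q ⊗ r
⊗-distribʳ p q r = mk≋ λ w → begin
  coeff ((p ⊕ q) ⊗ r) w
    ≡⟨ coeff-⊗ (p ⊕ q) r w ⟩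
  convolution (coeff (p ⊕ q)) (coeff r) w
    ≡⟨ ∑ℚ-cong (λ s → trans (cong (_*q coeff r (proj₂ s)) (coeff-++ p q (proj₁ s)))
                            (ℚP.*-distribʳ-+ (coeff r (proj₂ s)) (coeff p (proj₁ s)) (coeff q (proj₁ s)))) (splittings w) ⟩
  ∑ℚ (λ s → coeff p (proj₁ s) *q coeff r (proj₂ s) +q coeff q (proj₁ s) *q coeff r (proj₂ s)) (splittings w)
    ≡⟨ ∑ℚ-+ _ _ (splittings w) ⟩
  convolution (coeff p) (coeff r) w +q convolution (coeff q) (coeff r) w
    ≡⟨ sym (trans (coeff-++ (p ⊗ r) (q ⊗ r) w) (cong₂ _+q_ (coeff-⊗ p r w) (coeff-⊗ q r w))) ⟩
  coeff (p ⊗ r ⊕ q ⊗ r) w ∎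
  where open ≡-Reasoning

·-⊗ˡ : ∀ c p q → (c · p) ⊗ q ≋ c · (p ⊗ q)
·-⊗ˡ c p q = mk≋ λ w → begin
  coeff ((c · p) ⊗ q) w
    ≡⟨ coeff-⊗ (c · p) q w ⟩
  convolution (coeff (c · p)) (coeff q) w
    ≡⟨ ∑ℚ-cong (λ s → trans (cong (_*q coeff q (proj₂ s)) (coeff-· c p (proj₁ s)))
                            (ℚP.*-assoc c (coeff p (proj₁ s)) (coeff q (proj₂ s)))) (splittings w) ⟩
  ∑ℚ (λ s → c *q (coeff p (proj₁ s) *q coeff q (proj₂ s))) (splittings w)
    ≡⟨ ∑ℚ-*ˡ c _ (splittings w) ⟩
  c *q convolution (coeff p) (coeff q) w
    ≡⟨ sym (trans (coeff-· c (p ⊗ q) w) (cong (c *q_) (coeff-⊗ p q w))) ⟩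
  coeff (c · (p ⊗ q)) w ∎
  where open ≡-Reasoning

·-⊗ʳ : ∀ c p q → p ⊗ (c · q) ≋ c · (p ⊗ q)
·-⊗ʳ c p q = mk≋ λ w → begin
  coeff (p ⊗ (c · q)) w
    ≡⟨ coeff-⊗ p (c · q) w ⟩
  convolution (coeff p) (coeff (c · q)) w
    ≡⟨ ∑ℚ-cong (λ s → trans (cong (coeff p (proj₁ s) *q_) (coeff-· c q (proj₂ s)))
                            (solve 3 (λ a c b → a :* (c :* b) := c :* (a :* b)) refl (coeff p (proj₁ s)) c (coeff q (proj₂ s))))
               (splittings w) ⟩
  ∑ℚ (λ s → c *q (coeff p (proj₁ s) *q coeff q (proj₂ s))) (splittings w)
    ≡⟨ ∑ℚ-*ˡ c _ (splittings w) ⟩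
  c *q convolution (coeff p) (coeff q) w
    ≡⟨ sym (trans (coeff-· c (p ⊗ q) w) (cong (c *q_) (coeff-⊗ p q w))) ⟩
  coeff (c · (p ⊗ q)) w ∎
  where open ≡-Reasoning

⊗-zeroʳ : ∀ p → p ⊗ 𝟘 ≋ 𝟘
⊗-zeroʳ p = mk≋ λ w → trans (coeff-⊗ p 𝟘 w)
  (trans (∑ℚ-cong (λ s → ℚP.*-zeroʳ (coeff p (proj₁ s))) (splittings w)) (∑ℚ-zero (splittings w)))

⊗-identityˡ : ∀ p → 𝟙 ⊗ p ≋ p
⊗-identityˡ p = mk≋ λ w → trans (coeff-⊗ 𝟙 p w)
  (trans (∑ℚ-cong (λ s → cong (_*q coeff p (proj₂ s)) (coeff-𝟙 (proj₁ s))) (splittings w)) (convolution-unitˡ (coeff p) w))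

⊗-identityʳ : ∀ p → p ⊗ 𝟙 ≋ p
⊗-identityʳ p = mk≋ λ w → trans (coeff-⊗ p 𝟙 w)
  (trans (∑ℚ-cong (λ s → cong (coeff p (proj₁ s) *q_) (coeff-𝟙 (proj₂ s))) (splittings w)) (convolution-unitʳ (coeff p) w))

-- A pattern-free copy of _⊗_, for which associativity holds on the nose.
prefixBy : ℚ → Mono → ℚ × Mono → ℚ × Mono
prefixBy a m x = (a *q proj₁ x , m ++ proj₂ x)

mul : Poly → Poly → Poly
mul [] q = []
mul (t ∷ p) q = map (prefixBy (proj₁ t) (proj₂ t)) q ++ mul p q

⊗≡mul : ∀ p q → p ⊗ q ≡ mul p q
⊗≡mul [] q = refl
⊗≡mul ((a , m) ∷ p) q = cong₂ _++_ (map-cong (λ x → refl) q) (⊗≡mul p q)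

mul-++ : ∀ p p′ r → mul (p ++ p′) r ≡ mul p r ++ mul p′ r
mul-++ [] p′ r = refl
mul-++ (t ∷ p) p′ r =
  trans (cong (map (prefixBy (proj₁ t) (proj₂ t)) r ++_) (mul-++ p p′ r))
        (sym (++-assoc (map (prefixBy (proj₁ t) (proj₂ t)) r) (mul p r) (mul p′ r)))

mul-prefixBy : ∀ a m q r → mul (map (prefixBy a m) q) r ≡ map (prefixBy a m) (mul q r)
mul-prefixBy a m [] r = refl
mul-prefixBy a m (t ∷ q) r = begin
  map (prefixBy (a *q proj₁ t) (m ++ proj₂ t)) r ++ mul (map (prefixBy a m) q) r
    ≡⟨ cong₂ _++_ composite (mul-prefixBy a m q r) ⟩
  map (prefixBy a m) (map (prefixBy (proj₁ t) (proj₂ t)) r) ++ map (prefixBy a m) (mul q r)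
    ≡⟨ sym (map-++ (prefixBy a m) (map (prefixBy (proj₁ t) (proj₂ t)) r) (mul q r)) ⟩
  map (prefixBy a m) (map (prefixBy (proj₁ t) (proj₂ t)) r ++ mul q r) ∎
  where
  open ≡-Reasoning
  composite : map (prefixBy (a *q proj₁ t) (m ++ proj₂ t)) r ≡ map (prefixBy a m) (map (prefixBy (proj₁ t) (proj₂ t)) r)
  composite = trans (map-cong (λ x → cong₂ _,_ (ℚP.*-assoc a (proj₁ t) (proj₁ x)) (++-assoc m (proj₂ t) (proj₂ x))) r) (map-∘ r)

mul-assoc : ∀ p q r → mul (mul p q) r ≡ mul p (mul q r)
mul-assoc [] q r = refl
mul-assoc (t ∷ p) q r =
  trans (mul-++ (map (prefixBy (proj₁ t) (proj₂ t)) q) (mul p q) r)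
        (cong₂ _++_ (mul-prefixBy (proj₁ t) (proj₂ t) q r) (mul-assoc p q r))

⊗-assoc : ∀ p q r → (p ⊗ q) ⊗ r ≋ p ⊗ (q ⊗ r)
⊗-assoc p q r = ≡⇒≋ (begin
  (p ⊗ q) ⊗ r      ≡⟨ trans (⊗≡mul (p ⊗ q) r) (cong (λ z → mul z r) (⊗≡mul p q)) ⟩
  mul (mul p q) r  ≡⟨ mul-assoc p q r ⟩
  mul p (mul q r)  ≡⟨ sym (trans (⊗≡mul p (q ⊗ r)) (cong (mul p) (⊗≡mul q r))) ⟩
  p ⊗ (q ⊗ r)      ∎)
  where open ≡-Reasoning

⊖-cong : ∀ {p p′ q q′} → p ≋ p′ → q ≋ q′ → p ⊖ q ≋ p′ ⊖ q′
⊖-cong e f = ⊕-cong e (·-cong (-q 1ℚ) f)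

⊗-⊖-distribˡ : ∀ p q r → p ⊗ (q ⊖ r) ≋ p ⊗ q ⊖ p ⊗ r
⊗-⊖-distribˡ p q r = ≋-trans (⊗-distribˡ p q ((-q 1ℚ) · r)) (⊕-congʳ (p ⊗ q) (·-⊗ʳ (-q 1ℚ) p r))

⊗-⊖-distribʳ : ∀ p q r → (q ⊖ r) ⊗ p ≋ q ⊗ p ⊖ r ⊗ p
⊗-⊖-distribʳ p q r = ≋-trans (⊗-distribʳ q ((-q 1ℚ) · r) p) (⊕-congʳ (q ⊗ p) (·-⊗ˡ (-q 1ℚ) r p))

module _ {A : Set} where

  ∑ : (A → Poly) → List A → Poly
  ∑ f xs = sumP (map f xs)

  ∑-cong : {f g : A → Poly} → (∀ x → f x ≋ g x) → ∀ xs → ∑ f xs ≋ ∑ g xs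
  ∑-cong e [] = ≋-refl
  ∑-cong e (x ∷ xs) = ⊕-cong (e x) (∑-cong e xs)

  ∑-cong-All : {f g : A → Poly} {Q : A → Set} → (∀ x → Q x → f x ≋ g x) → ∀ {xs} → All Q xs → ∑ f xs ≋ ∑ g xs
  ∑-cong-All e [] = ≋-refl
  ∑-cong-All e (qx ∷ qxs) = ⊕-cong (e _ qx) (∑-cong-All e qxs)

  ∑-zero : {f : A → Poly} → (∀ x → f x ≋ 𝟘) → ∀ xs → ∑ f xs ≋ 𝟘
  ∑-zero e [] = ≋-refl
  ∑-zero e (x ∷ xs) = ⊕-cong (e x) (∑-zero e xs)

  ∑-⊕ : (f g : A → Poly) → ∀ xs → ∑ (λ x → f x ⊕ g x) xs ≋ ∑ f xs ⊕ ∑ g xs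
  ∑-⊕ f g [] = ≋-refl
  ∑-⊕ f g (x ∷ xs) = ≋-trans (⊕-congʳ (f x ⊕ g x) (∑-⊕ f g xs)) (⊕-interchange (f x) (g x) (∑ f xs) (∑ g xs))

  ∑-· : (c : ℚ) (f : A → Poly) → ∀ xs → ∑ (λ x → c · f x) xs ≋ c · ∑ f xs
  ∑-· c f [] = ≋-refl
  ∑-· c f (x ∷ xs) = ≋-trans (⊕-congʳ (c · f x) (∑-· c f xs)) (≋-sym (·-distrib-⊕ c (f x) (∑ f xs)))

  ∑-⊗ʳ : (f : A → Poly) (q : Poly) → ∀ xs → ∑ (λ x → f x ⊗ q) xs ≋ ∑ f xs ⊗ q
  ∑-⊗ʳ f q [] = ≋-refl
  ∑-⊗ʳ f q (x ∷ xs) = ≋-trans (⊕-congʳ (f x ⊗ q) (∑-⊗ʳ f q xs)) (≋-sym (⊗-distribʳ (f x) (∑ f xs) q))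

  ∑-⊗ˡ : (q : Poly) (f : A → Poly) → ∀ xs → ∑ (λ x → q ⊗ f x) xs ≋ q ⊗ ∑ f xs
  ∑-⊗ˡ q f [] = ≋-sym (⊗-zeroʳ q)
  ∑-⊗ˡ q f (x ∷ xs) = ≋-trans (⊕-congʳ (q ⊗ f x) (∑-⊗ˡ q f xs)) (≋-sym (⊗-distribˡ q (f x) (∑ f xs)))

  ∑-·-⊗ʳ : (c : A → ℚ) (f : A → Poly) (q : Poly) → ∀ xs → ∑ (λ x → c x · (f x ⊗ q)) xs ≋ ∑ (λ x → c x · f x) xs ⊗ q
  ∑-·-⊗ʳ c f q xs = ≋-trans (∑-cong (λ x → ≋-sym (·-⊗ˡ (c x) (f x) q)) xs) (∑-⊗ʳ (λ x → c x · f x) q xs)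

  ∑-++ : (f : A → Poly) → ∀ xs ys → ∑ f (xs ++ ys) ≋ ∑ f xs ⊕ ∑ f ys
  ∑-++ f [] ys = ≋-refl
  ∑-++ f (x ∷ xs) ys = ≋-trans (⊕-congʳ (f x) (∑-++ f xs ys)) (≋-sym (⊕-assoc (f x) (∑ f xs) (∑ f ys)))

∑-map : {A B : Set} (f : B → Poly) (g : A → B) → ∀ xs → ∑ f (map g xs) ≡ ∑ (λ x → f (g x)) xs
∑-map f g [] = refl
∑-map f g (x ∷ xs) = cong (f (g x) ⊕_) (∑-map f g xs)

∑-concatMap : {A B : Set} (f : B → Poly) (g : A → List B) → ∀ xs → ∑ f (concatMap g xs) ≋ ∑ (λ x → ∑ f (g x)) xs
∑-concatMap f g [] = ≋-refl
∑-concatMap f g (x ∷ xs) = ≋-trans (∑-++ f (g x) (concatMap g xs)) (⊕-congʳ (∑ f (g x)) (∑-concatMap f g xs))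

prodP-cong : ∀ {A : Set} {f g : A → Poly} → (∀ x → f x ≋ g x) → ∀ xs → prodP (map f xs) ≋ prodP (map g xs)
prodP-cong e [] = ≋-refl
prodP-cong e (x ∷ xs) = ⊗-cong (e x) (prodP-cong e xs)

-- ℚ-linear combinations of polynomial atoms, with scalars that are polynomial expressions in
-- k rational variables.  An identity between two of them holds coefficientwise once it holds
-- as a ring identity in the scalars and the coefficients of the atoms, which the ring solver
-- for ℚ decides (linear-identity).

infixl 6 _⊞_ _⊟_
infixr 7 _⊠_

data LinExpr (k n : ℕ) : Set where
  atom : Fin n → LinExpr k n
  _⊞_ : LinExpr k n → LinExpr k n → LinExpr k n
  _⊠_ : Polynomial k → LinExpr k n → LinExpr k n
  nil : LinExpr k n

_⊟_ : ∀ {k n} → LinExpr k n → LinExpr k n → LinExpr k n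
a ⊟ b = a ⊞ (con (-q 1ℚ) ⊠ b)

⟦_⟧L : ∀ {k n} → LinExpr k n → Vec ℚ k → Vec Poly n → Poly
⟦ atom i ⟧L ρs ρa = lookup ρa i
⟦ a ⊞ b ⟧L ρs ρa = ⟦ a ⟧L ρs ρa ⊕ ⟦ b ⟧L ρs ρa
⟦ c ⊠ a ⟧L ρs ρa = ⟦ c ⟧ ρs · ⟦ a ⟧L ρs ρa
⟦ nil ⟧L ρs ρa = 𝟘

weaken : ∀ {k} n → Polynomial k → Polynomial (k + n)
weaken n (op o p q) = op o (weaken n p) (weaken n q)
weaken n (con c) = con c
weaken n (var x) = var (x Fin.↑ˡ n)
weaken n (p :^ e) = weaken n p :^ e
weaken n (:- p) = :- weaken n p

weaken-sound : ∀ {k} n (c : Polynomial k) (ρs : Vec ℚ k) (ρa : Vec ℚ n) → ⟦ weaken n c ⟧ (ρs Vec.++ ρa) ≡ ⟦ c ⟧ ρs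
weaken-sound n (op [+] p q) ρs ρa = cong₂ _+q_ (weaken-sound n p ρs ρa) (weaken-sound n q ρs ρa)
weaken-sound n (op [*] p q) ρs ρa = cong₂ _*q_ (weaken-sound n p ρs ρa) (weaken-sound n q ρs ρa)
weaken-sound n (con c) ρs ρa = refl
weaken-sound n (var x) ρs ρa = lookup-++ˡ ρs ρa x
weaken-sound n (p :^ e) ρs ρa rewrite weaken-sound n p ρs ρa = refl
weaken-sound n (:- p) ρs ρa = cong -q_ (weaken-sound n p ρs ρa)

coefficientPolynomial : ∀ {k n} → LinExpr k n → Polynomial (k + n)
coefficientPolynomial {k} (atom i) = var (k Fin.↑ʳ i)
coefficientPolynomial (a ⊞ b) = coefficientPolynomial a :+ coefficientPolynomial b
coefficientPolynomial {k} {n} (c ⊠ a) = weaken n c :* coefficientPolynomial a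
coefficientPolynomial nil = con 0ℚ

coeff-⟦⟧L : ∀ {k n} (e : LinExpr k n) ρs ρa w →
  coeff (⟦ e ⟧L ρs ρa) w ≡ ⟦ coefficientPolynomial e ⟧ (ρs Vec.++ Vec.map (λ p → coeff p w) ρa)
coeff-⟦⟧L (atom i) ρs ρa w = sym (trans (lookup-++ʳ ρs (Vec.map (λ p → coeff p w) ρa) i) (lookup-map i (λ p → coeff p w) ρa))
coeff-⟦⟧L (a ⊞ b) ρs ρa w =
  trans (coeff-++ (⟦ a ⟧L ρs ρa) (⟦ b ⟧L ρs ρa) w) (cong₂ _+q_ (coeff-⟦⟧L a ρs ρa w) (coeff-⟦⟧L b ρs ρa w))
coeff-⟦⟧L {k} {n} (c ⊠ a) ρs ρa w =
  trans (coeff-· (⟦ c ⟧ ρs) (⟦ a ⟧L ρs ρa) w)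
        (cong₂ _*q_ (sym (weaken-sound n c ρs (Vec.map (λ p → coeff p w) ρa))) (coeff-⟦⟧L a ρs ρa w))
coeff-⟦⟧L nil ρs ρa w = refl

linear-identity : ∀ {k n} (e₁ e₂ : LinExpr k n) (ρs : Vec ℚ k) (ρa : Vec Poly n) →
  (∀ ρ → ⟦ coefficientPolynomial e₁ ⟧↓ ρ ≡ ⟦ coefficientPolynomial e₂ ⟧↓ ρ) → ⟦ e₁ ⟧L ρs ρa ≋ ⟦ e₂ ⟧L ρs ρa
linear-identity e₁ e₂ ρs ρa normal-forms-agree = mk≋ λ w →
  let ρ = ρs Vec.++ Vec.map (λ p → coeff p w) ρa in
  trans (coeff-⟦⟧L e₁ ρs ρa w)
        (trans (sym (correct (coefficientPolynomial e₁) ρ))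
               (trans (normal-forms-agree ρ) (trans (correct (coefficientPolynomial e₂) ρ) (sym (coeff-⟦⟧L e₂ ρs ρa w)))))

⊗-⟦⟧L : ∀ {k n} p (e : LinExpr k n) ρs ρa → p ⊗ ⟦ e ⟧L ρs ρa ≋ ⟦ e ⟧L ρs (Vec.map (p ⊗_) ρa)
⊗-⟦⟧L p (atom i) ρs ρa = ≡⇒≋ (sym (lookup-map i (p ⊗_) ρa))
⊗-⟦⟧L p (a ⊞ b) ρs ρa = ≋-trans (⊗-distribˡ p (⟦ a ⟧L ρs ρa) (⟦ b ⟧L ρs ρa)) (⊕-cong (⊗-⟦⟧L p a ρs ρa) (⊗-⟦⟧L p b ρs ρa))
⊗-⟦⟧L p (c ⊠ a) ρs ρa = ≋-trans (·-⊗ʳ (⟦ c ⟧ ρs) p (⟦ a ⟧L ρs ρa)) (·-cong (⟦ c ⟧ ρs) (⊗-⟦⟧L p a ρs ρa))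
⊗-⟦⟧L p nil ρs ρa = ⊗-zeroʳ p

⟦⟧L-⊗ : ∀ {k n} p (e : LinExpr k n) ρs ρa → ⟦ e ⟧L ρs ρa ⊗ p ≋ ⟦ e ⟧L ρs (Vec.map (_⊗ p) ρa)
⟦⟧L-⊗ p (atom i) ρs ρa = ≡⇒≋ (sym (lookup-map i (_⊗ p) ρa))
⟦⟧L-⊗ p (a ⊞ b) ρs ρa = ≋-trans (⊗-distribʳ (⟦ a ⟧L ρs ρa) (⟦ b ⟧L ρs ρa) p) (⊕-cong (⟦⟧L-⊗ p a ρs ρa) (⟦⟧L-⊗ p b ρs ρa))
⟦⟧L-⊗ p (c ⊠ a) ρs ρa = ≋-trans (·-⊗ˡ (⟦ c ⟧ ρs) (⟦ a ⟧L ρs ρa) p) (·-cong (⟦ c ⟧ ρs) (⟦⟧L-⊗ p a ρs ρa))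
⟦⟧L-⊗ p nil ρs ρa = ≋-refl

∑-·-⊗-⊖ : ∀ {A : Set} (c : A → ℚ) (f g : A → Poly) (q r : Poly) xs →
  ∑ (λ x → c x · (f x ⊗ q ⊖ g x ⊗ r)) xs ≋ ∑ (λ x → c x · f x) xs ⊗ q ⊖ ∑ (λ x → c x · g x) xs ⊗ r
∑-·-⊗-⊖ c f g q r xs = begin
  ∑ (λ x → c x · (f x ⊗ q ⊖ g x ⊗ r)) xs
    ≈⟨ ∑-cong distribute xs ⟩
  ∑ (λ x → (c x · f x) ⊗ q ⊕ (-q 1ℚ) · ((c x · g x) ⊗ r)) xs
    ≈⟨ ∑-⊕ (λ x → (c x · f x) ⊗ q) (λ x → (-q 1ℚ) · ((c x · g x) ⊗ r)) xs ⟩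
  ∑ (λ x → (c x · f x) ⊗ q) xs ⊕ ∑ (λ x → (-q 1ℚ) · ((c x · g x) ⊗ r)) xs
    ≈⟨ ⊕-cong (∑-⊗ʳ (λ x → c x · f x) q xs)
              (≋-trans (∑-· (-q 1ℚ) (λ x → (c x · g x) ⊗ r) xs) (·-cong (-q 1ℚ) (∑-⊗ʳ (λ x → c x · g x) r xs))) ⟩
  ∑ (λ x → c x · f x) xs ⊗ q ⊖ ∑ (λ x → c x · g x) xs ⊗ r ∎
  where
  open ≋-Reasoning
  distribute : ∀ x → c x · (f x ⊗ q ⊖ g x ⊗ r) ≋ (c x · f x) ⊗ q ⊕ (-q 1ℚ) · ((c x · g x) ⊗ r)
  distribute x =
    ≋-trans (linear-identity (var zero ⊠ (atom (# 0) ⊟ atom (# 1))) ((var zero ⊠ atom (# 0)) ⊟ (var zero ⊠ atom (# 1)))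
                             (c x ∷ []) (f x ⊗ q ∷ g x ⊗ r ∷ []) (λ _ → refl))
            (⊕-cong (≋-sym (·-⊗ˡ (c x) (f x) q)) (·-cong (-q 1ℚ) (≋-sym (·-⊗ˡ (c x) (g x) r))))

-- Determinants

notIn : ∀ {n} → Fin n → List (Fin n) → Bool
notIn i [] = true
notIn i (j ∷ js) = not (toℕ i ≡ᵇ toℕ j) ∧ notIn i js

distinct : ∀ {n} → List (Fin n) → Bool
distinct [] = true
distinct (i ∷ is) = notIn i is ∧ distinct is

countBelow : ∀ {n} → Fin n → List (Fin n) → ℕ
countBelow i [] = 0
countBelow i (j ∷ js) = if toℕ j <ᵇ toℕ i then suc (countBelow i js) else countBelow i js

inv : ∀ {n} → List (Fin n) → ℕ
inv [] = 0
inv (i ∷ is) = countBelow i is + inv is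

isPerm≡distinct : ∀ {n} (σ : Vec (Fin n) n) → isPerm σ ≡ distinct (toList σ)
isPerm≡distinct σ = go (toList σ)
  where
  F : _ → Bool → Bool
  F = λ { (a , b) r → not (toℕ a ≡ᵇ toℕ b) ∧ r }
  go : ∀ l → foldr F true (pairsL l) ≡ distinct l
  go [] = refl
  go (a ∷ as) = begin
    foldr F true (map (λ b → (a , b)) as ++ pairsL as)
      ≡⟨ foldr-++ F true (map (λ b → (a , b)) as) (pairsL as) ⟩
    foldr F (foldr F true (pairsL as)) (map (λ b → (a , b)) as)
      ≡⟨ cong (λ r → foldr F r (map (λ b → (a , b)) as)) (go as) ⟩
    foldr F (distinct as) (map (λ b → (a , b)) as)
      ≡⟨ head-pairs as ⟩
    notIn a as ∧ distinct as ∎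
    where
    open ≡-Reasoning
    head-pairs : ∀ bs → foldr F (distinct as) (map (λ b → (a , b)) bs) ≡ notIn a bs ∧ distinct as
    head-pairs [] = refl
    head-pairs (b ∷ bs) =
      trans (cong (not (toℕ a ≡ᵇ toℕ b) ∧_) (head-pairs bs)) (sym (∧-assoc (not (toℕ a ≡ᵇ toℕ b)) (notIn a bs) (distinct as)))

inversions≡inv : ∀ {n} (σ : Vec (Fin n) n) → inversions σ ≡ inv (toList σ)
inversions≡inv σ = go (toList σ)
  where
  inverted? : Decidable {A = _ × _} (λ { (a , b) → toℕ b ℕ.< toℕ a })
  inverted? = λ { (a , b) → toℕ b ℕ.<? toℕ a }
  go : ∀ l → length (filter inverted? (pairsL l)) ≡ inv l
  go [] = refl
  go (a ∷ as) = begin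
    length (filter inverted? (map (λ b → (a , b)) as ++ pairsL as))
      ≡⟨ cong length (filter-++ inverted? (map (λ b → (a , b)) as) (pairsL as)) ⟩
    length (filter inverted? (map (λ b → (a , b)) as) ++ filter inverted? (pairsL as))
      ≡⟨ length-++ (filter inverted? (map (λ b → (a , b)) as)) ⟩
    length (filter inverted? (map (λ b → (a , b)) as)) + length (filter inverted? (pairsL as))
      ≡⟨ cong₂ _+_ (head-pairs as) (go as) ⟩
    countBelow a as + inv as ∎
    where
    open ≡-Reasoning
    head-pairs : ∀ bs → length (filter inverted? (map (λ b → (a , b)) bs)) ≡ countBelow a bs
    head-pairs [] = refl
    head-pairs (b ∷ bs) with toℕ b <ᵇ toℕ a
    ... | true = cong suc (head-pairs bs)
    ... | false = head-pairs bs

sgn-+ : ∀ a b → sgn (a + b) ≡ sgn a *q sgn b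
sgn-+ zero b = sym (ℚP.*-identityˡ (sgn b))
sgn-+ (suc a) b = trans (cong -q_ (sgn-+ a b)) (ℚP.neg-distribˡ-* (sgn a) (sgn b))

fins : ∀ k → List (Fin k)
fins k = toList (allFin k)

fins-suc : ∀ m → fins (suc m) ≡ zero ∷ map suc (fins m)
fins-suc m = trans (cong toList (allFin-map m)) (cong (zero ∷_) (toList-map suc (allFin m)))

∑-fins-suc : ∀ m (f : Fin (suc m) → Poly) → ∑ f (fins (suc m)) ≡ f zero ⊕ ∑ (λ j → f (suc j)) (fins m)
∑-fins-suc m f = trans (cong (∑ f) (fins-suc m)) (cong (f zero ⊕_) (∑-map f suc (fins m)))

-- signedDet n k w a is the signed sum, over the injective σ : Fin k → Fin n, of the products
-- a (σ 0) 0 ⋯ a (σ (k−1)) (k−1), with sign (−1)^(inv σ + ∑ⱼ w (σ j)).  For k = n and w = 0 it is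
-- det n a; the row weights w absorb the signs created by Laplace expansion.
columnProduct : ∀ {n k} → (Fin n → Fin k → Poly) → Vec (Fin n) k → Poly
columnProduct {k = k} a σ = prodP (map (λ j → a (lookup σ j) j) (fins k))

rowWeight : ∀ {n k} → (Fin n → ℕ) → Vec (Fin n) k → ℕ
rowWeight w [] = 0
rowWeight w (i ∷ σ) = w i + rowWeight w σ

signedTerm : ∀ {n k} → (Fin n → ℕ) → (Fin n → Fin k → Poly) → Vec (Fin n) k → Poly
signedTerm w a σ = if distinct (toList σ) then sgn (inv (toList σ) + rowWeight w σ) · columnProduct a σ else 𝟘

signedDet : ∀ n k → (Fin n → ℕ) → (Fin n → Fin k → Poly) → Poly
signedDet n k w a = ∑ (signedTerm w a) (allSeqs n k)

∑-filter : ∀ {A : Set} {Q : Pred A 0ℓ} (q? : Decidable Q) (f : A → Poly) xs →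
  ∑ f (filter q? xs) ≋ ∑ (λ x → if does (q? x) then f x else 𝟘) xs
∑-filter q? f [] = ≋-refl
∑-filter q? f (x ∷ xs) with does (q? x)
... | true = ⊕-congʳ (f x) (∑-filter q? f xs)
... | false = ∑-filter q? f xs

zeroWeight : ∀ {n} → Fin n → ℕ
zeroWeight _ = 0

rowWeight-zero : ∀ {n k} (σ : Vec (Fin n) k) → rowWeight zeroWeight σ ≡ 0
rowWeight-zero [] = refl
rowWeight-zero (i ∷ σ) = rowWeight-zero σ

det≋signedDet : ∀ n a → det n a ≋ signedDet n n zeroWeight a
det≋signedDet n a = ≋-trans (∑-filter (λ σ → T? (isPerm σ)) _ (allSeqs n n)) (∑-cong same-term (allSeqs n n))
  where
  open import Data.Bool using (T?)
  same-term : ∀ σ → (if isPerm σ then sgn (inversions σ) · columnProduct a σ else 𝟘) ≋ signedTerm zeroWeight a σ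
  same-term σ rewrite isPerm≡distinct σ | inversions≡inv σ | rowWeight-zero σ | ℕP.+-identityʳ (inv (toList σ)) = ≋-refl

columnProduct-∷ : ∀ {n k} (a : Fin n → Fin (suc k) → Poly) i (σ : Vec (Fin n) k) →
  columnProduct a (i ∷ σ) ≡ a i zero ⊗ columnProduct (λ r c → a r (suc c)) σ
columnProduct-∷ {k = k} a i σ =
  trans (cong (λ l → prodP (map (λ j → a (lookup (i ∷ σ) j) j) l)) (fins-suc k))
        (cong (λ l → a i zero ⊗ prodP l) (sym (map-∘ (fins k))))

isBelow : ℕ → ℕ → ℕ
isBelow x y = if x <ᵇ y then 1 else 0

rowWeight-isBelow : ∀ {n k} (w : Fin n → ℕ) (i : Fin n) (σ : Vec (Fin n) k) →
  rowWeight (λ j → w j + isBelow (toℕ j) (toℕ i)) σ ≡ rowWeight w σ + countBelow i (toList σ)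
rowWeight-isBelow w i [] = refl
rowWeight-isBelow w i (j ∷ σ) with toℕ j <ᵇ toℕ i
... | true = trans (cong (w j + 1 +_) (rowWeight-isBelow w i σ))
  (ℕS.solve 3 (λ x y z → x ℕS.:+ ℕS.con 1 ℕS.:+ (y ℕS.:+ z) ℕS.:= x ℕS.:+ y ℕS.:+ (ℕS.con 1 ℕS.:+ z)) refl
             (w j) (rowWeight w σ) (countBelow i (toList σ)))
  where module ℕS = ℕSolver.+-*-Solver
... | false = trans (cong₂ _+_ (ℕP.+-identityʳ (w j)) (rowWeight-isBelow w i σ))
                   (sym (ℕP.+-assoc (w j) (rowWeight w σ) (countBelow i (toList σ))))

signedTerm-∷ : ∀ {n k} (w : Fin n → ℕ) (a : Fin n → Fin (suc k) → Poly) i (σ : Vec (Fin n) k) →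
  signedTerm w a (i ∷ σ) ≋
    (if notIn i (toList σ)
     then sgn (w i) · (a i zero ⊗ signedTerm (λ j → w j + isBelow (toℕ j) (toℕ i)) (λ r c → a r (suc c)) σ)
     else 𝟘)
signedTerm-∷ w a i σ = by-cases (notIn i l) (distinct l)
  where
  l = toList σ
  w′ = λ j → w j + isBelow (toℕ j) (toℕ i)
  a′ = λ r c → a r (suc c)
  N = countBelow i l + inv l + (w i + rowWeight w σ)
  N≡ : N ≡ w i + (inv l + rowWeight w′ σ)
  N≡ = trans (ℕS.solve 4 (λ c v x s → c ℕS.:+ v ℕS.:+ (x ℕS.:+ s) ℕS.:= x ℕS.:+ (v ℕS.:+ (s ℕS.:+ c))) refl
                         (countBelow i l) (inv l) (w i) (rowWeight w σ))
             (cong (λ z → w i + (inv l + z)) (sym (rowWeight-isBelow w i σ)))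
    where module ℕS = ℕSolver.+-*-Solver
  by-cases : ∀ b d → (if b ∧ d then sgn N · columnProduct a (i ∷ σ) else 𝟘) ≋
    (if b then sgn (w i) · (a i zero ⊗ (if d then sgn (inv l + rowWeight w′ σ) · columnProduct a′ σ else 𝟘)) else 𝟘)
  by-cases false d = ≋-refl
  by-cases true false = ≋-sym (·-cong (sgn (w i)) (⊗-zeroʳ (a i zero)))
  by-cases true true = begin
    sgn N · columnProduct a (i ∷ σ)
      ≈⟨ ≡⇒≋ (cong₂ _·_ (trans (cong sgn N≡) (sgn-+ (w i) (inv l + rowWeight w′ σ))) (columnProduct-∷ a i σ)) ⟩
    (sgn (w i) *q sgn (inv l + rowWeight w′ σ)) · (a i zero ⊗ columnProduct a′ σ)
      ≈⟨ ≋-sym (·-assoc (sgn (w i)) (sgn (inv l + rowWeight w′ σ)) (a i zero ⊗ columnProduct a′ σ)) ⟩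
    sgn (w i) · (sgn (inv l + rowWeight w′ σ) · (a i zero ⊗ columnProduct a′ σ))
      ≈⟨ ·-cong (sgn (w i)) (≋-sym (·-⊗ʳ (sgn (inv l + rowWeight w′ σ)) (a i zero) (columnProduct a′ σ))) ⟩
    sgn (w i) · (a i zero ⊗ (sgn (inv l + rowWeight w′ σ) · columnProduct a′ σ)) ∎
    where open ≋-Reasoning

∑-if : ∀ {A : Set} b (h : A → Poly) xs → ∑ (λ x → if b then h x else 𝟘) xs ≋ (if b then ∑ h xs else 𝟘)
∑-if true h xs = ≋-refl
∑-if false h xs = ∑-zero (λ x → ≋-refl) xs

punchIn-≡ᵇ : ∀ {m} (i : Fin (suc m)) x y → (toℕ (punchIn i x) ≡ᵇ toℕ (punchIn i y)) ≡ (toℕ x ≡ᵇ toℕ y)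
punchIn-≡ᵇ zero x y = refl
punchIn-≡ᵇ (suc i) zero zero = refl
punchIn-≡ᵇ (suc i) zero (suc y) = refl
punchIn-≡ᵇ (suc i) (suc x) zero = refl
punchIn-≡ᵇ (suc i) (suc x) (suc y) = punchIn-≡ᵇ i x y

punchIn-<ᵇ : ∀ {m} (i : Fin (suc m)) x y → (toℕ (punchIn i x) <ᵇ toℕ (punchIn i y)) ≡ (toℕ x <ᵇ toℕ y)
punchIn-<ᵇ zero x y = refl
punchIn-<ᵇ (suc i) zero zero = refl
punchIn-<ᵇ (suc i) zero (suc y) = refl
punchIn-<ᵇ (suc i) (suc x) zero = refl
punchIn-<ᵇ (suc i) (suc x) (suc y) = punchIn-<ᵇ i x y

module _ {m : ℕ} (i : Fin (suc m)) where

  notIn-punchIn : ∀ x l → notIn (punchIn i x) (map (punchIn i) l) ≡ notIn x l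
  notIn-punchIn x [] = refl
  notIn-punchIn x (j ∷ l) = cong₂ (λ u v → not u ∧ v) (punchIn-≡ᵇ i x j) (notIn-punchIn x l)

  distinct-punchIn : ∀ l → distinct (map (punchIn i) l) ≡ distinct l
  distinct-punchIn [] = refl
  distinct-punchIn (j ∷ l) = cong₂ _∧_ (notIn-punchIn j l) (distinct-punchIn l)

  countBelow-punchIn : ∀ x l → countBelow (punchIn i x) (map (punchIn i) l) ≡ countBelow x l
  countBelow-punchIn x [] = refl
  countBelow-punchIn x (j ∷ l) rewrite punchIn-<ᵇ i j x | countBelow-punchIn x l = refl

  inv-punchIn : ∀ l → inv (map (punchIn i) l) ≡ inv l
  inv-punchIn [] = refl
  inv-punchIn (j ∷ l) = cong₂ _+_ (countBelow-punchIn j l) (inv-punchIn l)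

rowWeight-map : ∀ {n n′ k} (w : Fin n → ℕ) (g : Fin n′ → Fin n) (σ : Vec (Fin n′) k) →
  rowWeight w (Vec.map g σ) ≡ rowWeight (λ j → w (g j)) σ
rowWeight-map w g [] = refl
rowWeight-map w g (x ∷ σ) = cong (w (g x) +_) (rowWeight-map w g σ)

columnProduct-map : ∀ {n n′ k} (a : Fin n → Fin k → Poly) (g : Fin n′ → Fin n) (σ : Vec (Fin n′) k) →
  columnProduct a (Vec.map g σ) ≡ columnProduct (λ r c → a (g r) c) σ
columnProduct-map {k = k} a g σ = cong prodP (map-cong (λ j → cong (λ r → a r j) (lookup-map j g σ)) (fins k))

signedTerm-punchIn : ∀ {m k} (i : Fin (suc m)) (w : Fin (suc m) → ℕ) (a : Fin (suc m) → Fin k → Poly) (σ : Vec (Fin m) k) →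
  signedTerm w a (Vec.map (punchIn i) σ) ≡ signedTerm (λ j → w (punchIn i j)) (λ r c → a (punchIn i r) c) σ
signedTerm-punchIn i w a σ
  rewrite toList-map (punchIn i) σ | distinct-punchIn i (toList σ) | inv-punchIn i (toList σ)
        | rowWeight-map w (punchIn i) σ | columnProduct-map a (punchIn i) σ = refl

∑-fins-avoiding : ∀ {m} (i : Fin (suc m)) (H : Fin (suc m) → Poly) →
  ∑ (λ j → if not (toℕ i ≡ᵇ toℕ j) then H j else 𝟘) (fins (suc m)) ≋ ∑ (λ j → H (punchIn i j)) (fins m)
∑-fins-avoiding {m} zero H = ≡⇒≋ (∑-fins-suc m (λ j → if not (0 ≡ᵇ toℕ j) then H j else 𝟘))
∑-fins-avoiding {suc m} (suc i) H = begin
  ∑ (λ j → if not (toℕ (suc i) ≡ᵇ toℕ j) then H j else 𝟘) (fins (suc (suc m)))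
    ≡⟨ ∑-fins-suc (suc m) (λ j → if not (toℕ (suc i) ≡ᵇ toℕ j) then H j else 𝟘) ⟩
  H zero ⊕ ∑ (λ j → if not (toℕ i ≡ᵇ toℕ j) then H (suc j) else 𝟘) (fins (suc m))
    ≈⟨ ⊕-congʳ (H zero) (∑-fins-avoiding i (λ j → H (suc j))) ⟩
  H zero ⊕ ∑ (λ j → H (suc (punchIn i j))) (fins m)
    ≡⟨ sym (∑-fins-suc m (λ j → H (punchIn (suc i) j))) ⟩
  ∑ (λ j → H (punchIn (suc i) j)) (fins (suc m)) ∎
  where open ≋-Reasoning

∑-allSeqs-avoiding : ∀ {m} k (i : Fin (suc m)) (G : Vec (Fin (suc m)) k → Poly) →
  ∑ (λ σ → if notIn i (toList σ) then G σ else 𝟘) (allSeqs (suc m) k) ≋ ∑ (λ σ → G (Vec.map (punchIn i) σ)) (allSeqs m k)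
∑-allSeqs-avoiding zero i G = ≋-refl
∑-allSeqs-avoiding {m} (suc k) i G = begin
  ∑ avoiding (concatMap (λ j → map (j ∷_) (allSeqs (suc m) k)) (fins (suc m)))
    ≈⟨ ∑-concatMap avoiding (λ j → map (j ∷_) (allSeqs (suc m) k)) (fins (suc m)) ⟩
  ∑ (λ j → ∑ avoiding (map (j ∷_) (allSeqs (suc m) k))) (fins (suc m))
    ≈⟨ ∑-cong (λ j → ≡⇒≋ (∑-map avoiding (j ∷_) (allSeqs (suc m) k))) (fins (suc m)) ⟩
  ∑ (λ j → ∑ (λ σ → if not (toℕ i ≡ᵇ toℕ j) ∧ notIn i (toList σ) then G (j ∷ σ) else 𝟘) (allSeqs (suc m) k)) (fins (suc m))
    ≈⟨ ∑-cong (λ j → ≋-trans (∑-cong (λ σ → if-∧ (not (toℕ i ≡ᵇ toℕ j)) (notIn i (toList σ)) (G (j ∷ σ))) (allSeqs (suc m) k))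
                              (∑-if (not (toℕ i ≡ᵇ toℕ j)) (λ σ → tail-avoiding j σ) (allSeqs (suc m) k)))
              (fins (suc m)) ⟩
  ∑ (λ j → if not (toℕ i ≡ᵇ toℕ j) then ∑ (tail-avoiding j) (allSeqs (suc m) k) else 𝟘) (fins (suc m))
    ≈⟨ ∑-fins-avoiding i (λ j → ∑ (tail-avoiding j) (allSeqs (suc m) k)) ⟩
  ∑ (λ j → ∑ (tail-avoiding (punchIn i j)) (allSeqs (suc m) k)) (fins m)
    ≈⟨ ∑-cong (λ j → ∑-allSeqs-avoiding k i (λ σ → G (punchIn i j ∷ σ))) (fins m) ⟩
  ∑ (λ j → ∑ (λ σ → G (punchIn i j ∷ Vec.map (punchIn i) σ)) (allSeqs m k)) (fins m)
    ≈⟨ ∑-cong (λ j → ≡⇒≋ (sym (∑-map (λ σ → G (Vec.map (punchIn i) σ)) (j ∷_) (allSeqs m k)))) (fins m) ⟩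
  ∑ (λ j → ∑ (λ σ → G (Vec.map (punchIn i) σ)) (map (j ∷_) (allSeqs m k))) (fins m)
    ≈⟨ ≋-sym (∑-concatMap (λ σ → G (Vec.map (punchIn i) σ)) (λ j → map (j ∷_) (allSeqs m k)) (fins m)) ⟩
  ∑ (λ σ → G (Vec.map (punchIn i) σ)) (allSeqs m (suc k)) ∎
  where
  open ≋-Reasoning
  avoiding : Vec (Fin (suc m)) (suc k) → Poly
  avoiding σ = if notIn i (toList σ) then G σ else 𝟘
  tail-avoiding : Fin (suc m) → Vec (Fin (suc m)) k → Poly
  tail-avoiding j σ = if notIn i (toList σ) then G (j ∷ σ) else 𝟘
  if-∧ : ∀ b c x → (if b ∧ c then x else 𝟘) ≋ (if b then (if c then x else 𝟘) else 𝟘)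
  if-∧ true c x = ≋-refl
  if-∧ false c x = ≋-refl

minorWeight : ∀ {m} → (Fin (suc m) → ℕ) → Fin (suc m) → Fin m → ℕ
minorWeight w i j = w (punchIn i j) + isBelow (toℕ (punchIn i j)) (toℕ i)

minor : ∀ {m k} → (Fin (suc m) → Fin (suc k) → Poly) → Fin (suc m) → Fin m → Fin k → Poly
minor a i r c = a (punchIn i r) (suc c)

signedDet-expand : ∀ m k w a →
  signedDet (suc m) (suc k) w a ≋ ∑ (λ i → sgn (w i) · (a i zero ⊗ signedDet m k (minorWeight w i) (minor a i))) (fins (suc m))
signedDet-expand m k w a = begin
  ∑ (signedTerm w a) (concatMap (λ i → map (i ∷_) (allSeqs (suc m) k)) (fins (suc m)))
    ≈⟨ ∑-concatMap (signedTerm w a) (λ i → map (i ∷_) (allSeqs (suc m) k)) (fins (suc m)) ⟩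
  ∑ (λ i → ∑ (signedTerm w a) (map (i ∷_) (allSeqs (suc m) k))) (fins (suc m))
    ≈⟨ ∑-cong first-row (fins (suc m)) ⟩
  ∑ (λ i → sgn (w i) · (a i zero ⊗ signedDet m k (minorWeight w i) (minor a i))) (fins (suc m)) ∎
  where
  open ≋-Reasoning
  first-row : ∀ i → ∑ (signedTerm w a) (map (i ∷_) (allSeqs (suc m) k)) ≋ sgn (w i) · (a i zero ⊗ signedDet m k (minorWeight w i) (minor a i))
  first-row i = begin
    ∑ (signedTerm w a) (map (i ∷_) (allSeqs (suc m) k))
      ≡⟨ ∑-map (signedTerm w a) (i ∷_) (allSeqs (suc m) k) ⟩
    ∑ (λ σ → signedTerm w a (i ∷ σ)) (allSeqs (suc m) k)
      ≈⟨ ∑-cong (λ σ → signedTerm-∷ w a i σ) (allSeqs (suc m) k) ⟩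
    ∑ (λ σ → if notIn i (toList σ) then G σ else 𝟘) (allSeqs (suc m) k)
      ≈⟨ ∑-allSeqs-avoiding k i G ⟩
    ∑ (λ σ → G (Vec.map (punchIn i) σ)) (allSeqs m k)
      ≈⟨ ∑-cong (λ σ → ≡⇒≋ (cong (λ t → sgn (w i) · (a i zero ⊗ t))
                                  (signedTerm-punchIn i (λ j → w j + isBelow (toℕ j) (toℕ i)) (λ r c → a r (suc c)) σ)))
                (allSeqs m k) ⟩
    ∑ (λ σ → sgn (w i) · (a i zero ⊗ signedTerm (minorWeight w i) (minor a i) σ)) (allSeqs m k)
      ≈⟨ ∑-· (sgn (w i)) (λ σ → a i zero ⊗ signedTerm (minorWeight w i) (minor a i) σ) (allSeqs m k) ⟩
    sgn (w i) · ∑ (λ σ → a i zero ⊗ signedTerm (minorWeight w i) (minor a i) σ) (allSeqs m k)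
      ≈⟨ ·-cong (sgn (w i)) (∑-⊗ˡ (a i zero) (signedTerm (minorWeight w i) (minor a i)) (allSeqs m k)) ⟩
    sgn (w i) · (a i zero ⊗ signedDet m k (minorWeight w i) (minor a i)) ∎
    where
    G = λ σ → sgn (w i) · (a i zero ⊗ signedTerm (λ j → w j + isBelow (toℕ j) (toℕ i)) (λ r c → a r (suc c)) σ)

rowWeight-cong : ∀ {n k} {w w′ : Fin n → ℕ} → (∀ j → w j ≡ w′ j) → (σ : Vec (Fin n) k) → rowWeight w σ ≡ rowWeight w′ σ
rowWeight-cong e [] = refl
rowWeight-cong e (j ∷ σ) = cong₂ _+_ (e j) (rowWeight-cong e σ)

signedDet-cong : ∀ {n k} {w w′ : Fin n → ℕ} {a a′ : Fin n → Fin k → Poly} →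
  (∀ j → w j ≡ w′ j) → (∀ r c → a r c ≋ a′ r c) → signedDet n k w a ≋ signedDet n k w′ a′
signedDet-cong {n} {k} {w} {w′} {a} {a′} ew ea = ∑-cong same-term (allSeqs n k)
  where
  same-term : ∀ σ → signedTerm w a σ ≋ signedTerm w′ a′ σ
  same-term σ with distinct (toList σ)
  ... | false = ≋-refl
  ... | true = ≋-trans (≡⇒≋ (cong (λ z → sgn (inv (toList σ) + z) · columnProduct a σ) (rowWeight-cong ew σ)))
                       (·-cong (sgn (inv (toList σ) + rowWeight w′ σ)) (prodP-cong (λ j → ea (lookup σ j) j) (fins k)))

signedDet-zero-row : ∀ m w (a : Fin m → Fin m → Poly) (r : Fin m) → (∀ c → a r c ≋ 𝟘) → signedDet m m w a ≋ 𝟘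
signedDet-zero-row zero w a () h
signedDet-zero-row (suc m) w a r h = ≋-trans (signedDet-expand m m w a) (∑-zero vanishing (fins (suc m)))
  where
  vanishing : ∀ i → sgn (w i) · (a i zero ⊗ signedDet m m (minorWeight w i) (minor a i)) ≋ 𝟘
  vanishing i with i Fin.≟ r
  ... | yes refl = ·-cong (sgn (w i)) (⊗-congˡ (signedDet m m (minorWeight w i) (minor a i)) (h zero))
  ... | no i≢r = ≋-trans (·-cong (sgn (w i)) (⊗-congʳ (a i zero) (signedDet-zero-row m (minorWeight w i) (minor a i) (punchOut i≢r) minor-row)))
                         (·-cong (sgn (w i)) (⊗-zeroʳ (a i zero)))
    where
    minor-row : ∀ c → minor a i (punchOut i≢r) c ≋ 𝟘
    minor-row c rewrite punchIn-punchOut i≢r = h (suc c)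

signedDet-empty : ∀ (w : Fin 0 → ℕ) a → signedDet 0 0 w a ≋ 𝟙
signedDet-empty w a = ≋-trans (⊕-identityʳ (1ℚ · 𝟙)) (·-identity 𝟙)

signedDet-single : ∀ a → signedDet 1 1 zeroWeight a ≋ a zero zero
signedDet-single a = begin
  signedDet 1 1 zeroWeight a
    ≈⟨ signedDet-expand 0 0 zeroWeight a ⟩
  1ℚ · (a zero zero ⊗ signedDet 0 0 (minorWeight zeroWeight zero) (minor a zero)) ⊕ 𝟘
    ≈⟨ ≋-trans (⊕-identityʳ _) (·-identity (a zero zero ⊗ signedDet 0 0 (minorWeight zeroWeight zero) (minor a zero))) ⟩
  a zero zero ⊗ signedDet 0 0 (minorWeight zeroWeight zero) (minor a zero)
    ≈⟨ ≋-trans (⊗-congʳ (a zero zero) (signedDet-empty (minorWeight zeroWeight zero) (minor a zero))) (⊗-identityʳ (a zero zero)) ⟩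
  a zero zero ∎
  where open ≋-Reasoning

first-column-expansion : ∀ m (M : Fin (suc (suc m)) → Fin (suc (suc m)) → Poly) → (∀ i → M (suc (suc i)) zero ≋ 𝟘) →
  signedDet (suc (suc m)) (suc (suc m)) zeroWeight M ≋
    M zero zero ⊗ signedDet (suc m) (suc m) (minorWeight zeroWeight zero) (minor M zero)
    ⊕ M (suc zero) zero ⊗ signedDet (suc m) (suc m) (minorWeight zeroWeight (suc zero)) (minor M (suc zero))
first-column-expansion m M lower-rows = begin
  signedDet (suc (suc m)) (suc (suc m)) zeroWeight M
    ≈⟨ signedDet-expand (suc m) (suc m) zeroWeight M ⟩
  ∑ term (fins (suc (suc m)))
    ≡⟨ trans (∑-fins-suc (suc m) term) (cong (term zero ⊕_) (∑-fins-suc m (λ j → term (suc j)))) ⟩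
  term zero ⊕ (term (suc zero) ⊕ ∑ (λ j → term (suc (suc j))) (fins m))
    ≈⟨ ⊕-cong (·-identity (minor-term zero)) (⊕-cong (·-identity (minor-term (suc zero))) (∑-zero lower-terms (fins m))) ⟩
  minor-term zero ⊕ (minor-term (suc zero) ⊕ 𝟘)
    ≈⟨ ⊕-congʳ (minor-term zero) (⊕-identityʳ (minor-term (suc zero))) ⟩
  minor-term zero ⊕ minor-term (suc zero) ∎
  where
  open ≋-Reasoning
  minor-term : Fin (suc (suc m)) → Poly
  minor-term i = M i zero ⊗ signedDet (suc m) (suc m) (minorWeight zeroWeight i) (minor M i)
  term : Fin (suc (suc m)) → Poly
  term i = sgn 0 · minor-term i
  lower-terms : ∀ j → term (suc (suc j)) ≋ 𝟘
  lower-terms j = ·-cong 1ℚ (⊗-congˡ (signedDet (suc m) (suc m) (minorWeight zeroWeight (suc (suc j))) (minor M (suc (suc j))))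
                                    (lower-rows j))

-- Continuants

triMatrix qMatrix : ∀ {n} → Fin n → Fin n → Poly
triMatrix i j = tri (toℕ i) (toℕ j)
qMatrix i j = qEntry (toℕ i) (toℕ j)

P≋signedDet : ∀ n → P n ≋ signedDet n n zeroWeight triMatrix
P≋signedDet n = det≋signedDet n triMatrix

Q≋signedDet : ∀ k → Q k ≋ signedDet (suc k) (suc k) zeroWeight qMatrix
Q≋signedDet k = det≋signedDet (suc k) qMatrix

P-zero : P 0 ≋ 𝟙
P-zero = ≋-trans (P≋signedDet 0) (signedDet-empty zeroWeight triMatrix)

P-one : P 1 ≋ X
P-one = ≋-trans (P≋signedDet 1) (signedDet-single triMatrix)

Q-zero : Q 0 ≋ Y
Q-zero = ≋-trans (Q≋signedDet 0) (signedDet-single qMatrix)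

-- Deleting row 1 and column 0 of the tridiagonal matrix leaves Y in the corner and 𝟙 below
-- it; the cofactor of that 𝟙 has a zero row.
triMatrix-cofactor₁ : ∀ m →
  signedDet (suc m) (suc m) (minorWeight zeroWeight (suc zero)) (minor triMatrix (suc zero)) ≋ (-q 1ℚ) · (Y ⊗ P m)
triMatrix-cofactor₁ m = begin
  signedDet (suc m) (suc m) w M
    ≈⟨ signedDet-expand m m w M ⟩
  ∑ term (fins (suc m))
    ≡⟨ ∑-fins-suc m term ⟩
  (-q 1ℚ) · (Y ⊗ signedDet m m zeroWeight triMatrix) ⊕ ∑ (λ j → term (suc j)) (fins m)
    ≈⟨ ⊕-cong (·-cong (-q 1ℚ) (⊗-congʳ Y (≋-sym (P≋signedDet m)))) (∑-zero lower-rows (fins m)) ⟩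
  (-q 1ℚ) · (Y ⊗ P m) ⊕ 𝟘
    ≈⟨ ⊕-identityʳ _ ⟩
  (-q 1ℚ) · (Y ⊗ P m) ∎
  where
  open ≋-Reasoning
  w = minorWeight zeroWeight (suc zero)
  M = minor triMatrix (suc zero)
  term = λ i → sgn (w i) · (M i zero ⊗ signedDet m m (minorWeight w i) (minor M i))
  lower-rows : ∀ j → term (suc j) ≋ 𝟘
  lower-rows zero =
    ≋-trans (·-cong (sgn (w (suc zero))) (⊗-congʳ (M (suc zero) zero)
                      (signedDet-zero-row m (minorWeight w (suc zero)) (minor M (suc zero)) zero (λ c → ≋-refl))))
            (·-cong (sgn (w (suc zero))) (⊗-zeroʳ (M (suc zero) zero)))
  lower-rows (suc j) = ≋-refl

qMatrix-minor₁ : ∀ {m} (r c : Fin (suc m)) → minor qMatrix (suc zero) r c ≋ minor triMatrix (suc zero) r c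
qMatrix-minor₁ zero zero = ≋-refl
qMatrix-minor₁ zero (suc c) = ≋-refl
qMatrix-minor₁ (suc r) c = ≋-refl

qMatrix-minor₀ : ∀ {m} (r c : Fin m) → minor qMatrix zero r c ≋ triMatrix r c
qMatrix-minor₀ zero zero = ≋-refl
qMatrix-minor₀ zero (suc zero) = ≋-refl
qMatrix-minor₀ zero (suc (suc c)) = ≋-refl
qMatrix-minor₀ (suc r) c = ≋-refl

P-step : ∀ m → P (suc (suc m)) ≋ X ⊗ P (suc m) ⊖ Y ⊗ P m
P-step m =
  ≋-trans (P≋signedDet (suc (suc m)))
          (≋-trans (first-column-expansion m triMatrix (λ i → ≋-refl))
                   (⊕-cong (⊗-congʳ X (≋-sym (P≋signedDet (suc m))))
                           (≋-trans (⊗-congʳ 𝟙 (triMatrix-cofactor₁ m)) (⊗-identityˡ _))))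

Q-step : ∀ m → Q (suc m) ≋ Y ⊗ P (suc m) ⊖ X ⊗ (Y ⊗ P m)
Q-step m =
  ≋-trans (Q≋signedDet (suc m))
          (≋-trans (first-column-expansion m qMatrix (λ i → ≋-refl))
                   (⊕-cong (⊗-congʳ Y cofactor₀) (≋-trans (⊗-congʳ X cofactor₁) (·-⊗ʳ (-q 1ℚ) X (Y ⊗ P m)))))
  where
  cofactor₀ : signedDet (suc m) (suc m) (minorWeight zeroWeight zero) (minor qMatrix zero) ≋ P (suc m)
  cofactor₀ = ≋-trans (signedDet-cong {suc m} {suc m} {minorWeight zeroWeight zero} {zeroWeight} {minor qMatrix zero} {triMatrix}
                                      (λ _ → refl) qMatrix-minor₀) (≋-sym (P≋signedDet (suc m)))
  w₁ = minorWeight zeroWeight (suc zero)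
  cofactor₁ : signedDet (suc m) (suc m) w₁ (minor qMatrix (suc zero)) ≋ (-q 1ℚ) · (Y ⊗ P m)
  cofactor₁ = ≋-trans (signedDet-cong {suc m} {suc m} {w₁} {w₁} {minor qMatrix (suc zero)} {minor triMatrix (suc zero)}
                                      (λ _ → refl) qMatrix-minor₁) (triMatrix-cofactor₁ m)

Pprev : ℕ → Poly
Pprev zero = 𝟘
Pprev (suc n) = P n

P-recˡ : ∀ k → P (suc k) ≋ X ⊗ P k ⊖ Y ⊗ Pprev k
P-recˡ zero = begin
  P 1                ≈⟨ P-one ⟩
  X                  ≈⟨ ≋-sym (⊗-identityʳ X) ⟩
  X ⊗ 𝟙              ≈⟨ ⊗-congʳ X (≋-sym P-zero) ⟩
  X ⊗ P 0            ≈⟨ ≋-sym (⊕-identityʳ (X ⊗ P 0)) ⟩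
  X ⊗ P 0 ⊕ 𝟘        ≈⟨ ⊕-congʳ (X ⊗ P 0) (≋-sym (·-cong (-q 1ℚ) (⊗-zeroʳ Y))) ⟩
  X ⊗ P 0 ⊖ Y ⊗ 𝟘    ∎
  where open ≋-Reasoning
P-recˡ (suc m) = P-step m

Q≋P-combination : ∀ k → Q k ≋ Y ⊗ P k ⊖ X ⊗ (Y ⊗ Pprev k)
Q≋P-combination zero = begin
  Q 0                       ≈⟨ Q-zero ⟩
  Y                         ≈⟨ ≋-sym (⊗-identityʳ Y) ⟩
  Y ⊗ 𝟙                     ≈⟨ ⊗-congʳ Y (≋-sym P-zero) ⟩
  Y ⊗ P 0                   ≈⟨ ≋-sym (⊕-identityʳ (Y ⊗ P 0)) ⟩
  Y ⊗ P 0 ⊕ 𝟘               ≈⟨ ⊕-congʳ (Y ⊗ P 0) (≋-sym (·-cong (-q 1ℚ) (≋-trans (⊗-congʳ X (⊗-zeroʳ Y)) (⊗-zeroʳ X)))) ⟩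
  Y ⊗ P 0 ⊖ X ⊗ (Y ⊗ 𝟘)     ∎
  where open ≋-Reasoning
Q≋P-combination (suc m) = Q-step m

⊗-⊖-regroup : ∀ a b c d e U V →
  a ⊗ (b ⊗ U ⊖ c ⊗ V) ⊖ d ⊗ (c ⊗ U ⊖ e ⊗ V) ≋ (a ⊗ b ⊖ d ⊗ c) ⊗ U ⊖ (a ⊗ c ⊖ d ⊗ e) ⊗ V
⊗-⊖-regroup a b c d e U V = begin
  a ⊗ (b ⊗ U ⊖ c ⊗ V) ⊖ d ⊗ (c ⊗ U ⊖ e ⊗ V)
    ≈⟨ ⊖-cong (⊗-⊖-distribˡ a (b ⊗ U) (c ⊗ V)) (⊗-⊖-distribˡ d (c ⊗ U) (e ⊗ V)) ⟩
  (a ⊗ (b ⊗ U) ⊖ a ⊗ (c ⊗ V)) ⊖ (d ⊗ (c ⊗ U) ⊖ d ⊗ (e ⊗ V))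
    ≈⟨ ⊖-cong (⊖-cong (≋-sym (⊗-assoc a b U)) (≋-sym (⊗-assoc a c V))) (⊖-cong (≋-sym (⊗-assoc d c U)) (≋-sym (⊗-assoc d e V))) ⟩
  ((a ⊗ b) ⊗ U ⊖ (a ⊗ c) ⊗ V) ⊖ ((d ⊗ c) ⊗ U ⊖ (d ⊗ e) ⊗ V)
    ≈⟨ linear-identity ((atom (# 0) ⊟ atom (# 1)) ⊟ (atom (# 2) ⊟ atom (# 3))) ((atom (# 0) ⊟ atom (# 2)) ⊟ (atom (# 1) ⊟ atom (# 3))) []
                       ((a ⊗ b) ⊗ U ∷ (a ⊗ c) ⊗ V ∷ (d ⊗ c) ⊗ U ∷ (d ⊗ e) ⊗ V ∷ []) (λ _ → refl) ⟩
  ((a ⊗ b) ⊗ U ⊖ (d ⊗ c) ⊗ U) ⊖ ((a ⊗ c) ⊗ V ⊖ (d ⊗ e) ⊗ V)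
    ≈⟨ ⊖-cong (≋-sym (⊗-⊖-distribʳ U (a ⊗ b) (d ⊗ c))) (≋-sym (⊗-⊖-distribʳ V (a ⊗ c) (d ⊗ e))) ⟩
  (a ⊗ b ⊖ d ⊗ c) ⊗ U ⊖ (a ⊗ c ⊖ d ⊗ e) ⊗ V ∎
  where open ≋-Reasoning

P-recʳ : ∀ k → P (suc k) ≋ P k ⊗ X ⊖ Pprev k ⊗ Y
P-recʳ zero = begin
  P 1                ≈⟨ P-one ⟩
  X                  ≈⟨ ≋-sym (⊗-identityˡ X) ⟩
  𝟙 ⊗ X              ≈⟨ ⊗-congˡ X (≋-sym P-zero) ⟩
  P 0 ⊗ X            ≈⟨ ≋-sym (⊕-identityʳ (P 0 ⊗ X)) ⟩
  P 0 ⊗ X ⊖ 𝟘 ⊗ Y    ∎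
  where open ≋-Reasoning
P-recʳ (suc zero) = begin
  P 2                ≈⟨ P-step 0 ⟩
  X ⊗ P 1 ⊖ Y ⊗ P 0  ≈⟨ ⊖-cong (⊗-congʳ X P-one) (≋-trans (⊗-congʳ Y P-zero) (⊗-identityʳ Y)) ⟩
  X ⊗ X ⊖ Y          ≈⟨ ⊖-cong (⊗-congˡ X (≋-sym P-one)) (≋-trans (≋-sym (⊗-identityˡ Y)) (⊗-congˡ Y (≋-sym P-zero))) ⟩
  P 1 ⊗ X ⊖ P 0 ⊗ Y  ∎
  where open ≋-Reasoning
P-recʳ (suc (suc m)) = begin
  P (suc (suc (suc m)))
    ≈⟨ P-step (suc m) ⟩
  X ⊗ P (suc (suc m)) ⊖ Y ⊗ P (suc m)
    ≈⟨ ⊖-cong (⊗-congʳ X (P-recʳ (suc m))) (⊗-congʳ Y (P-recʳ m)) ⟩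
  X ⊗ (P (suc m) ⊗ X ⊖ P m ⊗ Y) ⊖ Y ⊗ (P m ⊗ X ⊖ Pprev m ⊗ Y)
    ≈⟨ ⊗-⊖-regroup X (P (suc m)) (P m) Y (Pprev m) X Y ⟩
  (X ⊗ P (suc m) ⊖ Y ⊗ P m) ⊗ X ⊖ (X ⊗ P m ⊖ Y ⊗ Pprev m) ⊗ Y
    ≈⟨ ⊖-cong (⊗-congˡ X (≋-sym (P-recˡ (suc m)))) (⊗-congˡ Y (≋-sym (P-recˡ m))) ⟩
  P (suc (suc m)) ⊗ X ⊖ P (suc m) ⊗ Y ∎
  where open ≋-Reasoning

Q-one : Q 1 ≋ Q 0 ⊗ X ⊖ X ⊗ Y
Q-one = begin
  Q 1                          ≈⟨ Q-step 0 ⟩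
  Y ⊗ P 1 ⊖ X ⊗ (Y ⊗ P 0)      ≈⟨ ⊖-cong (⊗-congʳ Y P-one) (⊗-congʳ X (≋-trans (⊗-congʳ Y P-zero) (⊗-identityʳ Y))) ⟩
  Y ⊗ X ⊖ X ⊗ Y                ≈⟨ ⊖-cong (⊗-congˡ X (≋-sym Q-zero)) (≋-refl {X ⊗ Y}) ⟩
  Q 0 ⊗ X ⊖ X ⊗ Y              ∎
  where open ≋-Reasoning

Q-recʳ : ∀ k → Q (suc (suc k)) ≋ Q (suc k) ⊗ X ⊖ Q k ⊗ Y
Q-recʳ k = begin
  Q (suc (suc k))
    ≈⟨ Q-step (suc k) ⟩
  Y ⊗ P (suc (suc k)) ⊖ X ⊗ (Y ⊗ P (suc k))
    ≈⟨ ⊖-cong ≋-refl (≋-sym (⊗-assoc X Y (P (suc k)))) ⟩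
  Y ⊗ P (suc (suc k)) ⊖ (X ⊗ Y) ⊗ P (suc k)
    ≈⟨ ⊖-cong (⊗-congʳ Y (P-recʳ (suc k))) (⊗-congʳ (X ⊗ Y) (P-recʳ k)) ⟩
  Y ⊗ (P (suc k) ⊗ X ⊖ P k ⊗ Y) ⊖ (X ⊗ Y) ⊗ (P k ⊗ X ⊖ Pprev k ⊗ Y)
    ≈⟨ ⊗-⊖-regroup Y (P (suc k)) (P k) (X ⊗ Y) (Pprev k) X Y ⟩
  (Y ⊗ P (suc k) ⊖ (X ⊗ Y) ⊗ P k) ⊗ X ⊖ (Y ⊗ P k ⊖ (X ⊗ Y) ⊗ Pprev k) ⊗ Y
    ≈⟨ ⊖-cong (⊗-congˡ X (⊖-cong (≋-refl {Y ⊗ P (suc k)}) (⊗-assoc X Y (P k))))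
              (⊗-congˡ Y (⊖-cong (≋-refl {Y ⊗ P k}) (⊗-assoc X Y (Pprev k)))) ⟩
  (Y ⊗ P (suc k) ⊖ X ⊗ (Y ⊗ P k)) ⊗ X ⊖ (Y ⊗ P k ⊖ X ⊗ (Y ⊗ Pprev k)) ⊗ Y
    ≈⟨ ⊖-cong (⊗-congˡ X (≋-sym (Q≋P-combination (suc k)))) (⊗-congˡ Y (≋-sym (Q≋P-combination k))) ⟩
  Q (suc k) ⊗ X ⊖ Q k ⊗ Y ∎
  where open ≋-Reasoning

ones : ℕ → FWord
ones k = replicate k d1

bumpBlock : ℕ × List ℕ → ℕ × List ℕ
bumpBlock b = (suc (proj₁ b) , proj₂ b)

newBlock : ℕ × List ℕ → ℕ × List ℕ
newBlock b = (0 , proj₁ b ∷ proj₂ b)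

splitBlocks : FWord → ℕ × List ℕ
splitBlocks [] = (0 , [])
splitBlocks (d1 ∷ w) = bumpBlock (splitBlocks w)
splitBlocks (d2 ∷ w) = newBlock (splitBlocks w)

blocks≡splitBlocks : ∀ v → blocks v ≡ proj₁ (splitBlocks v) ∷ proj₂ (splitBlocks v)
blocks≡splitBlocks [] = refl
blocks≡splitBlocks (d1 ∷ v) rewrite blocks≡splitBlocks v = refl
blocks≡splitBlocks (d2 ∷ v) rewrite blocks≡splitBlocks v = refl

-- The last block of the first word merges with the first block of the second.
joinBlocks : ℕ → List ℕ → ℕ × List ℕ → ℕ × List ℕ
joinBlocks k [] z = (k + proj₁ z , proj₂ z)
joinBlocks k (k′ ∷ ks) z = (k , proj₁ (joinBlocks k′ ks z) ∷ proj₂ (joinBlocks k′ ks z))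

splitBlocks-++ : ∀ w z → splitBlocks (w ++ z) ≡ joinBlocks (proj₁ (splitBlocks w)) (proj₂ (splitBlocks w)) (splitBlocks z)
splitBlocks-++ [] z = refl
splitBlocks-++ (d1 ∷ w) z = trans (cong bumpBlock (splitBlocks-++ w z)) (bump-join (splitBlocks w))
  where
  bump-join : ∀ b → bumpBlock (joinBlocks (proj₁ b) (proj₂ b) (splitBlocks z)) ≡ joinBlocks (suc (proj₁ b)) (proj₂ b) (splitBlocks z)
  bump-join (k , []) = refl
  bump-join (k , k′ ∷ ks) = refl
splitBlocks-++ (d2 ∷ w) z = cong newBlock (splitBlocks-++ w z)

splitBlocks-ones-++ : ∀ b w → splitBlocks (ones b ++ w) ≡ (b + proj₁ (splitBlocks w) , proj₂ (splitBlocks w))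
splitBlocks-ones-++ zero w = refl
splitBlocks-ones-++ (suc b) w = cong bumpBlock (splitBlocks-ones-++ b w)

splitBlocks-ones : ∀ b → splitBlocks (ones b) ≡ (b , [])
splitBlocks-ones b =
  trans (cong splitBlocks (sym (++-identityʳ (ones b))))
        (trans (splitBlocks-ones-++ b []) (cong (λ x → (x , [])) (ℕP.+-identityʳ b)))

sBlocks : ℕ → List ℕ → Poly
sBlocks k [] = P k
sBlocks k (k′ ∷ ks) = sBlocks k′ ks ⊗ Q k

sOfBlocks : ℕ × List ℕ → Poly
sOfBlocks b = sBlocks (proj₁ b) (proj₂ b)

sReversed : List ℕ → Poly
sReversed [] = 𝟙
sReversed (k₀ ∷ ks) = P k₀ ⊗ prodP (map Q ks)

s≡sReversed : ∀ v → s v ≡ sReversed (reverse (blocks v))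
s≡sReversed v with reverse (blocks v)
... | [] = refl
... | k ∷ ks = refl

prodP-Q-∷ʳ : ∀ ks k → prodP (map Q (ks ++ k ∷ [])) ≋ prodP (map Q ks) ⊗ Q k
prodP-Q-∷ʳ [] k = ≋-trans (⊗-identityʳ (Q k)) (≋-sym (⊗-identityˡ (Q k)))
prodP-Q-∷ʳ (r ∷ rs) k = ≋-trans (⊗-congʳ (Q r) (prodP-Q-∷ʳ rs k)) (≋-sym (⊗-assoc (Q r) (prodP (map Q rs)) (Q k)))

sReversed-∷ʳ : ∀ l k′ k → sReversed ((l ++ k′ ∷ []) ++ k ∷ []) ≋ sReversed (l ++ k′ ∷ []) ⊗ Q k
sReversed-∷ʳ [] k′ k = ≋-trans (⊗-congʳ (P k′) (prodP-Q-∷ʳ [] k)) (≋-sym (⊗-assoc (P k′) 𝟙 (Q k)))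
sReversed-∷ʳ (r ∷ rs) k′ k =
  ≋-trans (⊗-congʳ (P r) (prodP-Q-∷ʳ (rs ++ k′ ∷ []) k)) (≋-sym (⊗-assoc (P r) (prodP (map Q (rs ++ k′ ∷ []))) (Q k)))

sReversed-reverse : ∀ k ks → sReversed (reverse (k ∷ ks)) ≋ sBlocks k ks
sReversed-reverse k [] = ⊗-identityʳ (P k)
sReversed-reverse k (k′ ∷ ks) = begin
  sReversed (reverse (k ∷ k′ ∷ ks))
    ≡⟨ cong sReversed (trans (unfold-reverse k (k′ ∷ ks)) (cong (_++ k ∷ []) (unfold-reverse k′ ks))) ⟩
  sReversed ((reverse ks ++ k′ ∷ []) ++ k ∷ [])
    ≈⟨ sReversed-∷ʳ (reverse ks) k′ k ⟩
  sReversed (reverse ks ++ k′ ∷ []) ⊗ Q k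
    ≡⟨ cong (λ l → sReversed l ⊗ Q k) (sym (unfold-reverse k′ ks)) ⟩
  sReversed (reverse (k′ ∷ ks)) ⊗ Q k
    ≈⟨ ⊗-congˡ (Q k) (sReversed-reverse k′ ks) ⟩
  sBlocks k′ ks ⊗ Q k ∎
  where open ≋-Reasoning

s≋sOfBlocks : ∀ v → s v ≋ sOfBlocks (splitBlocks v)
s≋sOfBlocks v =
  ≋-trans (≡⇒≋ (trans (s≡sReversed v) (cong (λ l → sReversed (reverse l)) (blocks≡splitBlocks v))))
          (sReversed-reverse (proj₁ (splitBlocks v)) (proj₂ (splitBlocks v)))

s-[] : s [] ≋ 𝟙
s-[] = ≋-trans (s≋sOfBlocks []) P-zero

s-1 : s (d1 ∷ []) ≋ X
s-1 = ≋-trans (s≋sOfBlocks (d1 ∷ [])) P-one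

s-2∷ : ∀ v → s (d2 ∷ v) ≋ s v ⊗ Y
s-2∷ v = ≋-trans (s≋sOfBlocks (d2 ∷ v))
  (≋-trans (⊗-congʳ (sOfBlocks (splitBlocks v)) Q-zero) (⊗-congˡ Y (≋-sym (s≋sOfBlocks v))))

sBlocks-recʳ : ∀ k ks → sBlocks (suc (suc k)) ks ≋ sBlocks (suc k) ks ⊗ X ⊖ sBlocks k ks ⊗ Y
sBlocks-recʳ k [] = P-recʳ (suc k)
sBlocks-recʳ k (k′ ∷ ks) = begin
  B ⊗ Q (suc (suc k))                      ≈⟨ ⊗-congʳ B (Q-recʳ k) ⟩
  B ⊗ (Q (suc k) ⊗ X ⊖ Q k ⊗ Y)            ≈⟨ ⊗-⊖-distribˡ B (Q (suc k) ⊗ X) (Q k ⊗ Y) ⟩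
  B ⊗ (Q (suc k) ⊗ X) ⊖ B ⊗ (Q k ⊗ Y)      ≈⟨ ⊖-cong (≋-sym (⊗-assoc B (Q (suc k)) X)) (≋-sym (⊗-assoc B (Q k) Y)) ⟩
  (B ⊗ Q (suc k)) ⊗ X ⊖ (B ⊗ Q k) ⊗ Y      ∎
  where
  open ≋-Reasoning
  B = sBlocks k′ ks

s-11∷ : ∀ v → s (d1 ∷ d1 ∷ v) ≋ s (d1 ∷ v) ⊗ X ⊖ s v ⊗ Y
s-11∷ v = ≋-trans (s≋sOfBlocks (d1 ∷ d1 ∷ v)) (≋-trans (sBlocks-recʳ (proj₁ (splitBlocks v)) (proj₂ (splitBlocks v)))
  (⊖-cong (⊗-congˡ X (≋-sym (s≋sOfBlocks (d1 ∷ v)))) (⊗-congˡ Y (≋-sym (s≋sOfBlocks v)))))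

s-12∷ : ∀ v → s (d1 ∷ d2 ∷ v) ≋ s (d2 ∷ v) ⊗ X ⊖ (s v ⊗ X) ⊗ Y
s-12∷ v = begin
  s (d1 ∷ d2 ∷ v)                      ≈⟨ s≋sOfBlocks (d1 ∷ d2 ∷ v) ⟩
  B ⊗ Q 1                              ≈⟨ ⊗-congʳ B Q-one ⟩
  B ⊗ (Q 0 ⊗ X ⊖ X ⊗ Y)                ≈⟨ ⊗-⊖-distribˡ B (Q 0 ⊗ X) (X ⊗ Y) ⟩
  B ⊗ (Q 0 ⊗ X) ⊖ B ⊗ (X ⊗ Y)          ≈⟨ ⊖-cong (≋-sym (⊗-assoc B (Q 0) X)) (≋-sym (⊗-assoc B X Y)) ⟩
  (B ⊗ Q 0) ⊗ X ⊖ (B ⊗ X) ⊗ Y          ≈⟨ ⊖-cong (⊗-congˡ X (≋-sym (s≋sOfBlocks (d2 ∷ v)))) (⊗-congˡ Y (⊗-congˡ X (≋-sym (s≋sOfBlocks v)))) ⟩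
  s (d2 ∷ v) ⊗ X ⊖ (s v ⊗ X) ⊗ Y      ∎
  where
  open ≋-Reasoning
  B = sOfBlocks (splitBlocks v)

s-ones-2∷ : ∀ b z → s (ones b ++ d2 ∷ z) ≋ s z ⊗ Q b
s-ones-2∷ b z = ≋-trans (s≋sOfBlocks (ones b ++ d2 ∷ z))
  (≋-trans (≡⇒≋ (trans (cong sOfBlocks (splitBlocks-ones-++ b (d2 ∷ z)))
                       (cong (λ x → sOfBlocks (splitBlocks z) ⊗ Q x) (ℕP.+-identityʳ b))))
           (⊗-congˡ (Q b) (≋-sym (s≋sOfBlocks z))))

s-ones : ∀ b → s (ones b) ≋ P b
s-ones b = ≋-trans (s≋sOfBlocks (ones b)) (≡⇒≋ (cong sOfBlocks (splitBlocks-ones b)))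

lastBlock : ℕ → List ℕ → ℕ
lastBlock k [] = k
lastBlock k (k′ ∷ ks) = lastBlock k′ ks

-- The factor of s w contributed by all blocks of w but the last.
QTail : ℕ → List ℕ → Poly
QTail k [] = 𝟙
QTail k (k′ ∷ ks) = QTail k′ ks ⊗ Q k

sOfBlocks-joinBlocks : ∀ k ks z → sOfBlocks (joinBlocks k ks z) ≋ sBlocks (lastBlock k ks + proj₁ z) (proj₂ z) ⊗ QTail k ks
sOfBlocks-joinBlocks k [] z = ≋-sym (⊗-identityʳ _)
sOfBlocks-joinBlocks k (k′ ∷ ks) z =
  ≋-trans (⊗-congˡ (Q k) (sOfBlocks-joinBlocks k′ ks z))
          (⊗-assoc (sBlocks (lastBlock k′ ks + proj₁ z) (proj₂ z)) (QTail k′ ks) (Q k))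

module _ (w : FWord) where

  lastBlockOf : ℕ
  lastBlockOf = lastBlock (proj₁ (splitBlocks w)) (proj₂ (splitBlocks w))

  QTailOf : Poly
  QTailOf = QTail (proj₁ (splitBlocks w)) (proj₂ (splitBlocks w))

  s-++ : ∀ z → s (w ++ z) ≋ s (ones lastBlockOf ++ z) ⊗ QTailOf
  s-++ z = begin
    s (w ++ z)
      ≈⟨ s≋sOfBlocks (w ++ z) ⟩
    sOfBlocks (splitBlocks (w ++ z))
      ≡⟨ cong sOfBlocks (splitBlocks-++ w z) ⟩
    sOfBlocks (joinBlocks (proj₁ (splitBlocks w)) (proj₂ (splitBlocks w)) (splitBlocks z))
      ≈⟨ sOfBlocks-joinBlocks (proj₁ (splitBlocks w)) (proj₂ (splitBlocks w)) (splitBlocks z) ⟩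
    sBlocks (lastBlockOf + proj₁ (splitBlocks z)) (proj₂ (splitBlocks z)) ⊗ QTailOf
      ≡⟨ cong (λ b → sOfBlocks b ⊗ QTailOf) (sym (splitBlocks-ones-++ lastBlockOf z)) ⟩
    sOfBlocks (splitBlocks (ones lastBlockOf ++ z)) ⊗ QTailOf
      ≈⟨ ⊗-congˡ QTailOf (≋-sym (s≋sOfBlocks (ones lastBlockOf ++ z))) ⟩
    s (ones lastBlockOf ++ z) ⊗ QTailOf ∎
    where open ≋-Reasoning

  s≋P⊗QTail : s w ≋ P lastBlockOf ⊗ QTailOf
  s≋P⊗QTail = begin
    s w                          ≡⟨ cong s (sym (++-identityʳ w)) ⟩
    s (w ++ [])                  ≈⟨ s-++ [] ⟩
    s (ones lastBlockOf ++ []) ⊗ QTailOf  ≈⟨ ⊗-congˡ QTailOf (≋-trans (≡⇒≋ (cong s (++-identityʳ (ones lastBlockOf)))) (s-ones lastBlockOf)) ⟩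
    P lastBlockOf ⊗ QTailOf      ∎
    where open ≋-Reasoning

pOfBlocks : List ℕ → Poly
pOfBlocks [] = 𝟙
pOfBlocks (kₜ ∷ ks) = prodP (map pfac (reverse ks)) ⊗ X ^ kₜ

p≡pOfBlocks : ∀ v → p v ≡ pOfBlocks (blocks v)
p≡pOfBlocks v with blocks v
... | [] = refl
... | k ∷ ks = refl

p-ones : ∀ m → p (ones m) ≋ X ^ m
p-ones m = ≋-trans (≡⇒≋ (trans (p≡pOfBlocks (ones m))
                               (cong pOfBlocks (trans (blocks≡splitBlocks (ones m)) (cong (λ b → proj₁ b ∷ proj₂ b) (splitBlocks-ones m))))))
                   (⊗-identityˡ (X ^ m))

p-++-2∷ones : ∀ u k → p (u ++ d2 ∷ ones k) ≋ pfac k ⊗ p u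
p-++-2∷ones u k = begin
  p (u ++ d2 ∷ ones k)
    ≡⟨ trans (p≡pOfBlocks (u ++ d2 ∷ ones k))
             (cong pOfBlocks (trans (blocks≡splitBlocks (u ++ d2 ∷ ones k)) (cong (λ b → proj₁ b ∷ proj₂ b) appended))) ⟩
  prodP (map pfac (reverse (ks ++ k ∷ []))) ⊗ X ^ kₜ
    ≡⟨ cong (λ l → prodP (map pfac l) ⊗ X ^ kₜ) (reverse-++ ks (k ∷ [])) ⟩
  (pfac k ⊗ prodP (map pfac (reverse ks))) ⊗ X ^ kₜ
    ≈⟨ ⊗-assoc (pfac k) (prodP (map pfac (reverse ks))) (X ^ kₜ) ⟩
  pfac k ⊗ pOfBlocks (kₜ ∷ ks)
    ≡⟨ cong (pfac k ⊗_) (sym (trans (p≡pOfBlocks u) (cong pOfBlocks (blocks≡splitBlocks u)))) ⟩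
  pfac k ⊗ p u ∎
  where
  open ≋-Reasoning
  kₜ = proj₁ (splitBlocks u)
  ks = proj₂ (splitBlocks u)
  join-new-block : ∀ k′ ks′ → joinBlocks k′ ks′ (0 , k ∷ []) ≡ (k′ , ks′ ++ k ∷ [])
  join-new-block k′ [] = cong (λ x → (x , k ∷ [])) (ℕP.+-identityʳ k′)
  join-new-block k′ (k″ ∷ ks′) = cong (λ b → (k′ , proj₁ b ∷ proj₂ b)) (join-new-block k″ ks′)
  appended : splitBlocks (u ++ d2 ∷ ones k) ≡ (kₜ , ks ++ k ∷ [])
  appended = trans (splitBlocks-++ u (d2 ∷ ones k))
                   (trans (cong (joinBlocks kₜ ks) (cong newBlock (splitBlocks-ones k))) (join-new-block kₜ ks))

ℕtoℚ-+ : ∀ a b → ℕtoℚ (a + b) ≡ ℕtoℚ a +q ℕtoℚ b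
ℕtoℚ-+ a b = ℚP.toℚᵘ-injective (ℚᵘP.≃-sym (ℚᵘP.≃-trans (ℚP.toℚᵘ-homo-+ (ℕtoℚ a) (ℕtoℚ b))
  (ℚᵘP.≃-trans (ℚᵘP.+-cong (ℚP.toℚᵘ-fromℚᵘ (ℚᵘ.mkℚᵘ (ℤ.+ a) 0)) (ℚP.toℚᵘ-fromℚᵘ (ℚᵘ.mkℚᵘ (ℤ.+ b) 0)))
    (ℚᵘP.≃-trans sum-of-integers (ℚᵘP.≃-sym (ℚP.toℚᵘ-fromℚᵘ (ℚᵘ.mkℚᵘ (ℤ.+ (a + b)) 0)))))))
  where
  open ≡-Reasoning
  sum-of-integers : ℚᵘ.mkℚᵘ (ℤ.+ a) 0 ℚᵘ.+ ℚᵘ.mkℚᵘ (ℤ.+ b) 0 ℚᵘ.≃ ℚᵘ.mkℚᵘ (ℤ.+ (a + b)) 0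
  sum-of-integers = ℚᵘ.*≡* (begin
    (ℤ.+ a ℤ.* ℤ.+ 1 ℤ.+ ℤ.+ b ℤ.* ℤ.+ 1) ℤ.* ℤ.+ 1  ≡⟨ ℤP.*-identityʳ _ ⟩
    ℤ.+ a ℤ.* ℤ.+ 1 ℤ.+ ℤ.+ b ℤ.* ℤ.+ 1               ≡⟨ cong₂ ℤ._+_ (ℤP.*-identityʳ (ℤ.+ a)) (ℤP.*-identityʳ (ℤ.+ b)) ⟩
    ℤ.+ a ℤ.+ ℤ.+ b                                   ≡⟨ sym (ℤP.pos-+ a b) ⟩
    ℤ.+ (a + b)                                       ≡⟨ sym (ℤP.*-identityʳ _) ⟩
    ℤ.+ (a + b) ℤ.* ℤ.+ 1                             ∎)

ℕtoℚ-suc : ∀ a → ℕtoℚ (suc a) ≡ ℕtoℚ a +q 1ℚ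
ℕtoℚ-suc a = trans (cong ℕtoℚ (ℕP.+-comm 1 a)) (ℕtoℚ-+ a 1)

-- Powers of X

positionProduct : FWord → ℚ
positionProduct [] = 1ℚ
positionProduct (d1 ∷ z) = positionProduct z
positionProduct (d2 ∷ z) = ℕtoℚ (suc (rank z)) *q positionProduct z

YF-rank : ∀ n → All (λ z → rank z ≡ n) (YF n)
YF-rank zero = refl ∷ []
YF-rank (suc zero) = refl ∷ []
YF-rank (suc (suc n)) =
  AllP.++⁺ (AllP.map⁺ (All.map (cong suc) (YF-rank (suc n)))) (AllP.map⁺ (All.map (cong (λ x → suc (suc x))) (YF-rank n)))

∑-YF : ∀ n (f : FWord → Poly) → ∑ f (YF (suc (suc n))) ≋ ∑ (λ z → f (d1 ∷ z)) (YF (suc n)) ⊕ ∑ (λ z → f (d2 ∷ z)) (YF n)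
∑-YF n f = ≋-trans (∑-++ f (map (d1 ∷_) (YF (suc n))) (map (d2 ∷_) (YF n)))
                   (≡⇒≋ (cong₂ _⊕_ (∑-map f (d1 ∷_) (YF (suc n))) (∑-map f (d2 ∷_) (YF n))))

∑-YF-2∷ : ∀ m (c : FWord → ℚ) (f : FWord → Poly) (g : FWord → Poly) → (∀ z → f (d2 ∷ z) ≋ g z) →
  ∑ (λ z → (ℕtoℚ (suc (rank z)) *q c z) · f (d2 ∷ z)) (YF m) ≋ ℕtoℚ (suc m) · ∑ (λ z → c z · g z) (YF m)
∑-YF-2∷ m c f g f≋g = ≋-trans
  (∑-cong-All (λ z rank≡m → ≋-trans (≡⇒≋ (cong (λ x → (ℕtoℚ (suc x) *q c z) · f (d2 ∷ z)) rank≡m))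
                                     (≋-trans (≋-sym (·-assoc (ℕtoℚ (suc m)) (c z) (f (d2 ∷ z))))
                                              (·-cong (ℕtoℚ (suc m)) (·-cong (c z) (f≋g z)))))
              (YF-rank m))
  (∑-· (ℕtoℚ (suc m)) (λ z → c z · g z) (YF m))

X^-∷ʳ : ∀ n → X ^ n ⊗ X ≋ X ^ suc n
X^-∷ʳ zero = ≋-trans (⊗-identityˡ X) (≋-sym (⊗-identityʳ X))
X^-∷ʳ (suc n) = ≋-trans (⊗-assoc X (X ^ n) X) (⊗-congʳ X (X^-∷ʳ n))

X^-suc-⊗ : ∀ n q → X ^ suc n ⊗ q ≋ X ^ n ⊗ (X ⊗ q)
X^-suc-⊗ n q = ≋-trans (⊗-congˡ q (≋-sym (X^-∷ʳ n))) (⊗-assoc (X ^ n) X q)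

powerSum headOneSum : ℕ → Poly
powerSum m = ∑ (λ z → positionProduct z · s z) (YF m)
headOneSum m = ∑ (λ z → positionProduct z · s (d1 ∷ z)) (YF m)

headOneValue : ℕ → Poly
headOneValue zero = X
headOneValue (suc m) = X ^ suc (suc m) ⊖ ℕtoℚ (suc m) · (X ^ m ⊗ Y)

powerSum-step : ∀ m → powerSum (suc (suc m)) ≋ headOneSum (suc m) ⊕ ℕtoℚ (suc m) · (powerSum m ⊗ Y)
powerSum-step m = ≋-trans (∑-YF m (λ z → positionProduct z · s z)) (⊕-congʳ (headOneSum (suc m))
  (≋-trans (∑-YF-2∷ m positionProduct s (λ z → s z ⊗ Y) s-2∷)
           (·-cong (ℕtoℚ (suc m)) (∑-·-⊗ʳ positionProduct s Y (YF m)))))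

headOneSum-step : ∀ m → headOneSum (suc (suc m)) ≋
  (headOneSum (suc m) ⊗ X ⊖ powerSum (suc m) ⊗ Y) ⊕ ℕtoℚ (suc m) · ((powerSum m ⊗ Y) ⊗ X ⊖ (powerSum m ⊗ X) ⊗ Y)
headOneSum-step m = ≋-trans (∑-YF m (λ z → positionProduct z · s (d1 ∷ z))) (⊕-cong leading-1 leading-2)
  where
  leading-1 : ∑ (λ z → positionProduct z · s (d1 ∷ d1 ∷ z)) (YF (suc m)) ≋ headOneSum (suc m) ⊗ X ⊖ powerSum (suc m) ⊗ Y
  leading-1 = ≋-trans (∑-cong (λ z → ·-cong (positionProduct z) (s-11∷ z)) (YF (suc m)))
                      (∑-·-⊗-⊖ positionProduct (λ z → s (d1 ∷ z)) s X Y (YF (suc m)))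
  leading-2 : ∑ (λ z → (ℕtoℚ (suc (rank z)) *q positionProduct z) · s (d1 ∷ d2 ∷ z)) (YF m) ≋
              ℕtoℚ (suc m) · ((powerSum m ⊗ Y) ⊗ X ⊖ (powerSum m ⊗ X) ⊗ Y)
  leading-2 = ≋-trans (∑-YF-2∷ m positionProduct (λ w → s (d1 ∷ w)) (λ z → s (d2 ∷ z) ⊗ X ⊖ (s z ⊗ X) ⊗ Y) s-12∷)
    (·-cong (ℕtoℚ (suc m))
      (≋-trans (∑-·-⊗-⊖ positionProduct (λ z → s (d2 ∷ z)) (λ z → s z ⊗ X) X Y (YF m))
               (⊖-cong (⊗-congˡ X (≋-trans (∑-cong (λ z → ·-cong (positionProduct z) (s-2∷ z)) (YF m)) (∑-·-⊗ʳ positionProduct s Y (YF m))))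
                       (⊗-congˡ Y (∑-·-⊗ʳ positionProduct s X (YF m))))))

powerValue-step : ∀ m → headOneValue (suc m) ⊕ ℕtoℚ (suc m) · (X ^ m ⊗ Y) ≋ X ^ suc (suc m)
powerValue-step m =
  linear-identity ((atom (# 0) ⊟ (var zero ⊠ atom (# 1))) ⊞ (var zero ⊠ atom (# 1))) (atom (# 0))
                  (ℕtoℚ (suc m) ∷ []) (X ^ suc (suc m) ∷ X ^ m ⊗ Y ∷ []) (λ _ → refl)

headOneValue-step : ∀ m →
  (headOneValue (suc m) ⊗ X ⊖ X ^ suc m ⊗ Y) ⊕ ℕtoℚ (suc m) · ((X ^ m ⊗ Y) ⊗ X ⊖ (X ^ m ⊗ X) ⊗ Y) ≋ headOneValue (suc (suc m))
headOneValue-step m = begin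
  (headOneValue (suc m) ⊗ X ⊖ X ^ suc m ⊗ Y) ⊕ c · ((X ^ m ⊗ Y) ⊗ X ⊖ (X ^ m ⊗ X) ⊗ Y)
    ≈⟨ ⊕-cong (⊖-cong (⟦⟧L-⊗ X (atom (# 0) ⊟ (var zero ⊠ atom (# 1))) (c ∷ []) (X ^ suc (suc m) ∷ X ^ m ⊗ Y ∷ [])) (≋-refl {X ^ suc m ⊗ Y}))
              (·-cong c (⊖-cong (≋-refl {(X ^ m ⊗ Y) ⊗ X}) (⊗-congˡ Y (X^-∷ʳ m)))) ⟩
  ((X ^ suc (suc m) ⊗ X ⊖ c · ((X ^ m ⊗ Y) ⊗ X)) ⊖ X ^ suc m ⊗ Y) ⊕ c · ((X ^ m ⊗ Y) ⊗ X ⊖ X ^ suc m ⊗ Y)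
    ≈⟨ ⊕-congˡ (c · ((X ^ m ⊗ Y) ⊗ X ⊖ X ^ suc m ⊗ Y))
               (⊖-cong (⊖-cong (X^-∷ʳ (suc (suc m))) (≋-refl {c · ((X ^ m ⊗ Y) ⊗ X)})) (≋-refl {X ^ suc m ⊗ Y})) ⟩
  ((X ^ suc (suc (suc m)) ⊖ c · ((X ^ m ⊗ Y) ⊗ X)) ⊖ X ^ suc m ⊗ Y) ⊕ c · ((X ^ m ⊗ Y) ⊗ X ⊖ X ^ suc m ⊗ Y)
    ≈⟨ linear-identity (((atom (# 0) ⊟ (var zero ⊠ atom (# 1))) ⊟ atom (# 2)) ⊞ (var zero ⊠ (atom (# 1) ⊟ atom (# 2))))
                       (atom (# 0) ⊟ ((var zero :+ con 1ℚ) ⊠ atom (# 2)))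
                       (c ∷ []) (X ^ suc (suc (suc m)) ∷ (X ^ m ⊗ Y) ⊗ X ∷ X ^ suc m ⊗ Y ∷ []) (λ _ → refl) ⟩
  X ^ suc (suc (suc m)) ⊖ (c +q 1ℚ) · (X ^ suc m ⊗ Y)
    ≈⟨ ⊖-cong (≋-refl {X ^ suc (suc (suc m))}) (≡⇒≋ (cong (λ x → x · (X ^ suc m ⊗ Y)) (sym (ℕtoℚ-suc (suc m))))) ⟩
  headOneValue (suc (suc m)) ∎
  where
  open ≋-Reasoning
  c = ℕtoℚ (suc m)

powerSum-headOneSum : ∀ m →
  (powerSum m ≋ X ^ m × headOneSum m ≋ headOneValue m) × (powerSum (suc m) ≋ X ^ suc m × headOneSum (suc m) ≋ headOneValue (suc m))
powerSum-headOneSum zero = (powerSum₀ , headOneSum₀) , (≋-trans headOneSum₀ (≋-sym (⊗-identityʳ X)) , headOneSum₁)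
  where
  open ≋-Reasoning
  powerSum₀ : powerSum 0 ≋ 𝟙
  powerSum₀ = ≋-trans (⊕-identityʳ _) (≋-trans (·-identity (s [])) s-[])
  headOneSum₀ : headOneSum 0 ≋ X
  headOneSum₀ = ≋-trans (⊕-identityʳ _) (≋-trans (·-identity (s (d1 ∷ []))) s-1)
  headOneSum₁ : headOneSum 1 ≋ headOneValue 1
  headOneSum₁ = begin
    headOneSum 1                  ≈⟨ ≋-trans (⊕-identityʳ _) (·-identity _) ⟩
    s (d1 ∷ d1 ∷ [])              ≈⟨ s-11∷ [] ⟩
    s (d1 ∷ []) ⊗ X ⊖ s [] ⊗ Y    ≈⟨ ⊖-cong (⊗-congˡ X (≋-trans s-1 (≋-sym (⊗-identityʳ X))))
                                             (≋-trans (⊗-congˡ Y s-[]) (≋-sym (·-identity (𝟙 ⊗ Y)))) ⟩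
    (X ⊗ 𝟙) ⊗ X ⊖ 1ℚ · (𝟙 ⊗ Y)    ≈⟨ ⊖-cong (X^-∷ʳ 1) (≋-refl {1ℚ · (𝟙 ⊗ Y)}) ⟩
    headOneValue 1                ∎
powerSum-headOneSum (suc m) with powerSum-headOneSum m
... | (powerSumₘ , _) , (powerSumₘ₊₁ , headOneSumₘ₊₁) = (powerSumₘ₊₁ , headOneSumₘ₊₁) , (powerSumₘ₊₂ , headOneSumₘ₊₂)
  where
  powerSumₘ₊₂ : powerSum (suc (suc m)) ≋ X ^ suc (suc m)
  powerSumₘ₊₂ = ≋-trans (powerSum-step m)
    (≋-trans (⊕-cong headOneSumₘ₊₁ (·-cong (ℕtoℚ (suc m)) (⊗-congˡ Y powerSumₘ))) (powerValue-step m))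
  headOneSumₘ₊₂ : headOneSum (suc (suc m)) ≋ headOneValue (suc (suc m))
  headOneSumₘ₊₂ = ≋-trans (headOneSum-step m)
    (≋-trans (⊕-cong (⊖-cong (⊗-congˡ X headOneSumₘ₊₁) (⊗-congˡ Y powerSumₘ₊₁))
                     (·-cong (ℕtoℚ (suc m)) (⊖-cong (⊗-congˡ X (⊗-congˡ Y powerSumₘ)) (⊗-congˡ Y (⊗-congˡ X powerSumₘ)))))
             (headOneValue-step m))

X^≋∑ : ∀ m → X ^ m ≋ ∑ (λ z → positionProduct z · s z) (YF m)
X^≋∑ m = ≋-sym (proj₁ (proj₁ (powerSum-headOneSum m)))

X⊗P : ∀ a → X ⊗ P a ≋ P (suc a) ⊕ Y ⊗ Pprev a
X⊗P a = ≋-trans (linear-identity (atom (# 0)) ((atom (# 0) ⊟ atom (# 1)) ⊞ atom (# 1)) [] (X ⊗ P a ∷ Y ⊗ Pprev a ∷ []) (λ _ → refl))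
                (⊕-congˡ (Y ⊗ Pprev a) (≋-sym (P-recˡ a)))

X⊗X⊗P : ∀ a → X ⊗ (X ⊗ P a) ≋ (P (suc (suc a)) ⊕ Y ⊗ P a) ⊕ X ⊗ (Y ⊗ Pprev a)
X⊗X⊗P a = begin
  X ⊗ (X ⊗ P a)                                    ≈⟨ ⊗-congʳ X (X⊗P a) ⟩
  X ⊗ (P (suc a) ⊕ Y ⊗ Pprev a)                    ≈⟨ ⊗-distribˡ X (P (suc a)) (Y ⊗ Pprev a) ⟩
  X ⊗ P (suc a) ⊕ X ⊗ (Y ⊗ Pprev a)                ≈⟨ ⊕-congˡ (X ⊗ (Y ⊗ Pprev a)) (X⊗P (suc a)) ⟩
  (P (suc (suc a)) ⊕ Y ⊗ P a) ⊕ X ⊗ (Y ⊗ Pprev a)  ∎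
  where open ≋-Reasoning

pfac-⊗ : ∀ k q → pfac k ⊗ q ≋ X ^ k ⊗ (X ⊗ (X ⊗ q)) ⊖ ℕtoℚ (suc (suc k)) · (X ^ k ⊗ (Y ⊗ q))
pfac-⊗ k q = begin
  pfac k ⊗ q
    ≈⟨ ⊗-⊖-distribʳ q (X ^ suc (suc k)) (c · (X ^ k ⊗ Y)) ⟩
  X ^ suc (suc k) ⊗ q ⊖ (c · (X ^ k ⊗ Y)) ⊗ q
    ≈⟨ ⊖-cong (≋-trans (X^-suc-⊗ (suc k) q) (X^-suc-⊗ k (X ⊗ q))) (≋-trans (·-⊗ˡ c (X ^ k ⊗ Y) q) (·-cong c (⊗-assoc (X ^ k) Y q))) ⟩
  X ^ k ⊗ (X ⊗ (X ⊗ q)) ⊖ c · (X ^ k ⊗ (Y ⊗ q)) ∎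
  where
  open ≋-Reasoning
  c = ℕtoℚ (suc (suc k))

onesPrefixValue : ℕ → ℕ → Poly
onesPrefixValue b zero = P b
onesPrefixValue b (suc zero) = P (suc b)
onesPrefixValue b (suc (suc j)) = onesPrefixValue (suc b) (suc j) ⊕ ℕtoℚ (suc j) · (X ^ j ⊗ Q b)

ones-∷ʳ-++ : ∀ b z → ones b ++ d1 ∷ z ≡ ones (suc b) ++ z
ones-∷ʳ-++ zero z = refl
ones-∷ʳ-++ (suc b) z = cong (d1 ∷_) (ones-∷ʳ-++ b z)

onesPrefixSum≋ : ∀ j b → ∑ (λ z → positionProduct z · s (ones b ++ z)) (YF j) ≋ onesPrefixValue b j
onesPrefixSum≋ zero b =
  ≋-trans (⊕-identityʳ _) (≋-trans (·-identity _) (≋-trans (≡⇒≋ (cong s (++-identityʳ (ones b)))) (s-ones b)))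
onesPrefixSum≋ (suc zero) b =
  ≋-trans (⊕-identityʳ _)
          (≋-trans (·-identity _) (≋-trans (≡⇒≋ (cong s (trans (ones-∷ʳ-++ b []) (++-identityʳ (ones (suc b)))))) (s-ones (suc b))))
onesPrefixSum≋ (suc (suc j)) b = ≋-trans (∑-YF j (λ z → positionProduct z · s (ones b ++ z)))
  (⊕-cong (≋-trans (∑-cong (λ z → ≡⇒≋ (cong (λ w → positionProduct z · s w) (ones-∷ʳ-++ b z))) (YF (suc j)))
                   (onesPrefixSum≋ (suc j) (suc b)))
          leading-2)
  where
  leading-2 : ∑ (λ z → (ℕtoℚ (suc (rank z)) *q positionProduct z) · s (ones b ++ d2 ∷ z)) (YF j) ≋ ℕtoℚ (suc j) · (X ^ j ⊗ Q b)
  leading-2 = ≋-trans (∑-YF-2∷ j positionProduct (λ w → s (ones b ++ w)) (λ z → s z ⊗ Q b) (s-ones-2∷ b))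
                      (·-cong (ℕtoℚ (suc j)) (≋-trans (∑-·-⊗ʳ positionProduct s (Q b) (YF j)) (⊗-congˡ (Q b) (≋-sym (X^≋∑ j)))))

pfac₀-⊗-P : ∀ a → pfac 0 ⊗ P a ≋ P (suc (suc a)) ⊖ Q a
pfac₀-⊗-P a = begin
  pfac 0 ⊗ P a
    ≈⟨ pfac-⊗ 0 (P a) ⟩
  𝟙 ⊗ (X ⊗ (X ⊗ P a)) ⊖ ℕtoℚ 2 · (𝟙 ⊗ (Y ⊗ P a))
    ≈⟨ ⊖-cong (≋-trans (⊗-identityˡ _) (X⊗X⊗P a))
              (≋-trans (≡⇒≋ (cong (_· (𝟙 ⊗ (Y ⊗ P a))) (ℕtoℚ-suc 1))) (·-cong (1ℚ +q 1ℚ) (⊗-identityˡ (Y ⊗ P a)))) ⟩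
  ((P (suc (suc a)) ⊕ Y ⊗ P a) ⊕ X ⊗ (Y ⊗ Pprev a)) ⊖ (1ℚ +q 1ℚ) · (Y ⊗ P a)
    ≈⟨ linear-identity (((atom (# 0) ⊞ atom (# 1)) ⊞ atom (# 2)) ⊟ ((con 1ℚ :+ con 1ℚ) ⊠ atom (# 1))) (atom (# 0) ⊟ (atom (# 1) ⊟ atom (# 2)))
                       [] (P (suc (suc a)) ∷ Y ⊗ P a ∷ X ⊗ (Y ⊗ Pprev a) ∷ []) (λ _ → refl) ⟩
  P (suc (suc a)) ⊖ (Y ⊗ P a ⊖ X ⊗ (Y ⊗ Pprev a))
    ≈⟨ ⊖-cong (≋-refl {P (suc (suc a))}) (≋-sym (Q≋P-combination a)) ⟩
  P (suc (suc a)) ⊖ Q a ∎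
  where open ≋-Reasoning

pfac-suc-⊗-P : ∀ k a →
  pfac (suc k) ⊗ P a ≋ (pfac k ⊗ P (suc a) ⊕ ℕtoℚ (suc (suc k)) · (X ^ k ⊗ Q (suc a))) ⊖ X ^ suc k ⊗ Q a
pfac-suc-⊗-P k a = begin
  pfac (suc k) ⊗ P a
    ≈⟨ pfac-⊗ (suc k) (P a) ⟩
  X ^ suc k ⊗ (X ⊗ (X ⊗ P a)) ⊖ ℕtoℚ (suc (suc (suc k))) · (X ^ suc k ⊗ (Y ⊗ P a))
    ≈⟨ ⊖-cong (≋-trans (X^-suc-⊗ k (X ⊗ (X ⊗ P a))) (≋-trans (⊗-congʳ W X³⊗P) (⊗-⟦⟧L W ((atom (# 0) ⊞ atom (# 1)) ⊞ atom (# 2)) [] (α ∷ β ∷ γ ∷ []))))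
              (≋-trans (≡⇒≋ (cong (_· (X ^ suc k ⊗ (Y ⊗ P a))) (trans (ℕtoℚ-suc (suc (suc k))) (cong (_+q 1ℚ) (ℕtoℚ-suc (suc k))))))
                       (·-cong (c +q 1ℚ +q 1ℚ) (X^-suc-⊗ k (Y ⊗ P a)))) ⟩
  ((W ⊗ α ⊕ W ⊗ β) ⊕ W ⊗ γ) ⊖ (c +q 1ℚ +q 1ℚ) · (W ⊗ β)
    ≈⟨ linear-identity (((atom (# 0) ⊞ atom (# 1)) ⊞ atom (# 2)) ⊟ (((var zero :+ con 1ℚ) :+ con 1ℚ) ⊠ atom (# 1)))
                       ((((atom (# 0) ⊞ atom (# 1)) ⊟ ((var zero :+ con 1ℚ) ⊠ atom (# 3))) ⊞ ((var zero :+ con 1ℚ) ⊠ (atom (# 3) ⊟ atom (# 1))))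
                          ⊟ (atom (# 1) ⊟ atom (# 2)))
                       (c ∷ []) (W ⊗ α ∷ W ⊗ β ∷ W ⊗ γ ∷ W ⊗ δ ∷ []) (λ _ → refl) ⟩
  (((W ⊗ α ⊕ W ⊗ β) ⊖ (c +q 1ℚ) · (W ⊗ δ)) ⊕ (c +q 1ℚ) · (W ⊗ δ ⊖ W ⊗ β)) ⊖ (W ⊗ β ⊖ W ⊗ γ)
    ≈⟨ ⊖-cong (⊕-cong (≋-sym pfac-⊗-P-suc)
                      (≋-trans (·-cong (c +q 1ℚ) (≋-sym W⊗Q-suc)) (≡⇒≋ (cong (_· (W ⊗ Q (suc a))) (sym (ℕtoℚ-suc (suc k)))))))
              (≋-sym X^-suc-⊗-Q) ⟩
  (pfac k ⊗ P (suc a) ⊕ ℕtoℚ (suc (suc k)) · (W ⊗ Q (suc a))) ⊖ X ^ suc k ⊗ Q a ∎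
  where
  open ≋-Reasoning
  W = X ^ k
  c = ℕtoℚ (suc k)
  α = X ⊗ P (suc (suc a))
  β = X ⊗ (Y ⊗ P a)
  γ = X ⊗ (X ⊗ (Y ⊗ Pprev a))
  δ = Y ⊗ P (suc a)
  X³⊗P : X ⊗ (X ⊗ (X ⊗ P a)) ≋ (α ⊕ β) ⊕ γ
  X³⊗P = ≋-trans (⊗-congʳ X (X⊗X⊗P a))
                 (⊗-⟦⟧L X ((atom (# 0) ⊞ atom (# 1)) ⊞ atom (# 2)) [] (P (suc (suc a)) ∷ Y ⊗ P a ∷ X ⊗ (Y ⊗ Pprev a) ∷ []))
  pfac-⊗-P-suc : pfac k ⊗ P (suc a) ≋ (W ⊗ α ⊕ W ⊗ β) ⊖ (c +q 1ℚ) · (W ⊗ δ)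
  pfac-⊗-P-suc =
    ≋-trans (pfac-⊗ k (P (suc a)))
            (⊖-cong (≋-trans (⊗-congʳ W (≋-trans (⊗-congʳ X (X⊗P (suc a))) (⊗-distribˡ X (P (suc (suc a))) (Y ⊗ P a))))
                             (⊗-distribˡ W α β))
                    (≡⇒≋ (cong (_· (W ⊗ δ)) (ℕtoℚ-suc (suc k)))))
  W⊗Q-suc : W ⊗ Q (suc a) ≋ W ⊗ δ ⊖ W ⊗ β
  W⊗Q-suc = ≋-trans (⊗-congʳ W (Q≋P-combination (suc a))) (⊗-⊖-distribˡ W δ β)
  X^-suc-⊗-Q : X ^ suc k ⊗ Q a ≋ W ⊗ β ⊖ W ⊗ γ
  X^-suc-⊗-Q = ≋-trans (X^-suc-⊗ k (Q a))
    (≋-trans (⊗-congʳ W (≋-trans (⊗-congʳ X (Q≋P-combination a)) (⊗-⊖-distribˡ X (Y ⊗ P a) (X ⊗ (Y ⊗ Pprev a)))))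
             (⊗-⊖-distribˡ W β γ))

pfac-⊗-P : ∀ k a → pfac k ⊗ P a ≋ onesPrefixValue (suc a) (suc k) ⊖ X ^ k ⊗ Q a
pfac-⊗-P zero a = ≋-trans (pfac₀-⊗-P a) (⊖-cong (≋-refl {P (suc (suc a))}) (≋-sym (⊗-identityˡ (Q a))))
pfac-⊗-P (suc k) a = begin
  pfac (suc k) ⊗ P a
    ≈⟨ pfac-suc-⊗-P k a ⟩
  (pfac k ⊗ P (suc a) ⊕ ℕtoℚ (suc (suc k)) · q) ⊖ X ^ suc k ⊗ Q a
    ≈⟨ ⊖-cong (⊕-cong (pfac-⊗-P k (suc a)) (≡⇒≋ (cong (_· q) (ℕtoℚ-suc (suc k))))) (≋-refl {X ^ suc k ⊗ Q a}) ⟩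
  ((H ⊖ q) ⊕ (c +q 1ℚ) · q) ⊖ X ^ suc k ⊗ Q a
    ≈⟨ ⊖-cong (linear-identity ((atom (# 0) ⊟ atom (# 1)) ⊞ ((var zero :+ con 1ℚ) ⊠ atom (# 1))) (atom (# 0) ⊞ (var zero ⊠ atom (# 1)))
                               (c ∷ []) (H ∷ q ∷ []) (λ _ → refl))
              (≋-refl {X ^ suc k ⊗ Q a}) ⟩
  onesPrefixValue (suc a) (suc (suc k)) ⊖ X ^ suc k ⊗ Q a ∎
  where
  open ≋-Reasoning
  c = ℕtoℚ (suc k)
  q = X ^ k ⊗ Q (suc a)
  H = onesPrefixValue (suc (suc a)) (suc k)

pfacCoefficient : FWord → ℚ
pfacCoefficient [] = 1ℚ
pfacCoefficient (d1 ∷ z) = positionProduct z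
pfacCoefficient (d2 ∷ z) = -q positionProduct z

neg-· : ∀ c q → (-q c) · q ≋ (-q 1ℚ) · (c · q)
neg-· c q = ≋-trans (≡⇒≋ (cong (_· q) (trans (cong -q_ (sym (ℚP.*-identityˡ c))) (ℚP.neg-distribˡ-* 1ℚ c))))
                    (≋-sym (·-assoc (-q 1ℚ) c q))

pfac-⊗-P≋∑ : ∀ k a → pfac k ⊗ P a ≋ ∑ (λ z → pfacCoefficient z · s (ones a ++ z)) (YF (suc (suc k)))
pfac-⊗-P≋∑ k a = ≋-trans (pfac-⊗-P k a) (≋-sym (≋-trans (∑-YF k (λ z → pfacCoefficient z · s (ones a ++ z))) (⊕-cong leading-1 leading-2)))
  where
  open ≋-Reasoning
  leading-1 : ∑ (λ z → positionProduct z · s (ones a ++ d1 ∷ z)) (YF (suc k)) ≋ onesPrefixValue (suc a) (suc k)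
  leading-1 = ≋-trans (∑-cong (λ z → ≡⇒≋ (cong (λ w → positionProduct z · s w) (ones-∷ʳ-++ a z))) (YF (suc k)))
                      (onesPrefixSum≋ (suc k) (suc a))
  leading-2 : ∑ (λ z → (-q positionProduct z) · s (ones a ++ d2 ∷ z)) (YF k) ≋ (-q 1ℚ) · (X ^ k ⊗ Q a)
  leading-2 = begin
    ∑ (λ z → (-q positionProduct z) · s (ones a ++ d2 ∷ z)) (YF k)
      ≈⟨ ∑-cong (λ z → ≋-trans (neg-· (positionProduct z) (s (ones a ++ d2 ∷ z)))
                               (·-cong (-q 1ℚ) (·-cong (positionProduct z) (s-ones-2∷ a z)))) (YF k) ⟩
    ∑ (λ z → (-q 1ℚ) · (positionProduct z · (s z ⊗ Q a))) (YF k)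
      ≈⟨ ∑-· (-q 1ℚ) (λ z → positionProduct z · (s z ⊗ Q a)) (YF k) ⟩
    (-q 1ℚ) · ∑ (λ z → positionProduct z · (s z ⊗ Q a)) (YF k)
      ≈⟨ ·-cong (-q 1ℚ) (≋-trans (∑-·-⊗ʳ positionProduct s (Q a) (YF k)) (⊗-congˡ (Q a) (≋-sym (X^≋∑ k)))) ⟩
    (-q 1ℚ) · (X ^ k ⊗ Q a) ∎

-- Only the last block of w interacts with the factor.
pfac-⊗-s : ∀ k w → pfac k ⊗ s w ≋ ∑ (λ z → pfacCoefficient z · s (w ++ z)) (YF (suc (suc k)))
pfac-⊗-s k w = begin
  pfac k ⊗ s w
    ≈⟨ ⊗-congʳ (pfac k) (s≋P⊗QTail w) ⟩
  pfac k ⊗ (P a ⊗ Tail)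
    ≈⟨ ≋-sym (⊗-assoc (pfac k) (P a) Tail) ⟩
  (pfac k ⊗ P a) ⊗ Tail
    ≈⟨ ⊗-congˡ Tail (pfac-⊗-P≋∑ k a) ⟩
  ∑ (λ z → pfacCoefficient z · s (ones a ++ z)) (YF (suc (suc k))) ⊗ Tail
    ≈⟨ ≋-sym (∑-·-⊗ʳ pfacCoefficient (λ z → s (ones a ++ z)) Tail (YF (suc (suc k)))) ⟩
  ∑ (λ z → pfacCoefficient z · (s (ones a ++ z) ⊗ Tail)) (YF (suc (suc k)))
    ≈⟨ ∑-cong (λ z → ·-cong (pfacCoefficient z) (≋-sym (s-++ w z))) (YF (suc (suc k))) ⟩
  ∑ (λ z → pfacCoefficient z · s (w ++ z)) (YF (suc (suc k))) ∎
  where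
  open ≋-Reasoning
  a = lastBlockOf w
  Tail = QTailOf w

-- The coefficient formula

T-ext : ∀ {b c : Bool} → (T b → T c) → (T c → T b) → b ≡ c
T-ext {true} {true} f g = refl
T-ext {true} {false} f g = ⊥-elim (f tt)
T-ext {false} {true} f g = ⊥-elim (g tt)
T-ext {false} {false} f g = refl

<ᵇ-true : ∀ {a b} → a < b → (a <ᵇ b) ≡ true
<ᵇ-true {a} {b} a<b = T-ext {a <ᵇ b} {true} (λ _ → tt) (λ _ → ℕP.<⇒<ᵇ a<b)

<ᵇ-false : ∀ {a b} → b ≤ a → (a <ᵇ b) ≡ false
<ᵇ-false {a} {b} b≤a = T-ext {a <ᵇ b} {false} (λ t → ℕP.<⇒≱ (ℕP.<ᵇ⇒< a b t) b≤a) (λ ())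

≤ᵇ-true : ∀ {a b} → a ≤ b → (a ≤ᵇ b) ≡ true
≤ᵇ-true {a} {b} a≤b = T-ext {a ≤ᵇ b} {true} (λ _ → tt) (λ _ → ℕP.≤⇒≤ᵇ a≤b)

≤ᵇ-false : ∀ {a b} → b < a → (a ≤ᵇ b) ≡ false
≤ᵇ-false {a} {b} b<a = T-ext {a ≤ᵇ b} {false} (λ t → ℕP.<⇒≱ b<a (ℕP.≤ᵇ⇒≤ a b t)) (λ ())

≤ᵇ-+ʳ : ∀ a b K → (a + K ≤ᵇ b + K) ≡ (a ≤ᵇ b)
≤ᵇ-+ʳ a b K = T-ext (λ t → ℕP.≤⇒≤ᵇ (ℕP.+-cancelʳ-≤ K a b (ℕP.≤ᵇ⇒≤ (a + K) (b + K) t)))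
                    (λ t → ℕP.≤⇒≤ᵇ (ℕP.+-monoˡ-≤ K {a} {b} (ℕP.≤ᵇ⇒≤ a b t)))

<ᵇ-+ʳ : ∀ a b K → (a + K <ᵇ b + K) ≡ (a <ᵇ b)
<ᵇ-+ʳ a b K = T-ext (λ t → ℕP.<⇒<ᵇ (ℕP.+-cancelʳ-< K a b (ℕP.<ᵇ⇒< (a + K) (b + K) t)))
                    (λ t → ℕP.<⇒<ᵇ (ℕP.+-monoˡ-< K {a} {b} (ℕP.<ᵇ⇒< a b t)))

module _ {A : Set} where

  filterᵇ-++ : ∀ (f : A → Bool) xs ys → filterᵇ f (xs ++ ys) ≡ filterᵇ f xs ++ filterᵇ f ys
  filterᵇ-++ f [] ys = refl
  filterᵇ-++ f (x ∷ xs) ys with f x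
  ... | true = cong (x ∷_) (filterᵇ-++ f xs ys)
  ... | false = filterᵇ-++ f xs ys

  filterᵇ-cong : ∀ {f g : A → Bool} xs → All (λ x → f x ≡ g x) xs → filterᵇ f xs ≡ filterᵇ g xs
  filterᵇ-cong [] [] = refl
  filterᵇ-cong {f} {g} (x ∷ xs) (fx≡gx ∷ rest) rewrite fx≡gx with g x
  ... | true = cong (x ∷_) (filterᵇ-cong xs rest)
  ... | false = filterᵇ-cong xs rest

  filterᵇ-all : ∀ (f : A → Bool) xs → All (λ x → f x ≡ true) xs → filterᵇ f xs ≡ xs
  filterᵇ-all f [] [] = refl
  filterᵇ-all f (x ∷ xs) (fx ∷ rest) rewrite fx = cong (x ∷_) (filterᵇ-all f xs rest)

  filterᵇ-none : ∀ (f : A → Bool) xs → All (λ x → f x ≡ false) xs → filterᵇ f xs ≡ []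
  filterᵇ-none f [] [] = refl
  filterᵇ-none f (x ∷ xs) (fx ∷ rest) rewrite fx = filterᵇ-none f xs rest

filterᵇ-map : ∀ {A B : Set} (f : B → Bool) (g : A → B) xs → filterᵇ f (map g xs) ≡ map g (filterᵇ (λ x → f (g x)) xs)
filterᵇ-map f g [] = refl
filterᵇ-map f g (x ∷ xs) with f (g x)
... | true = cong (g x ∷_) (filterᵇ-map f g xs)
... | false = filterᵇ-map f g xs

prodQ-++ : ∀ xs ys → prodQ (xs ++ ys) ≡ prodQ xs *q prodQ ys
prodQ-++ [] ys = sym (ℚP.*-identityˡ (prodQ ys))
prodQ-++ (x ∷ xs) ys = trans (cong (x *q_) (prodQ-++ xs ys)) (sym (ℚP.*-assoc x (prodQ xs) (prodQ ys)))

prodQ-map-cong : ∀ {A : Set} {f g : A → ℚ} xs → (∀ x → f x ≡ g x) → prodQ (map f xs) ≡ prodQ (map g xs)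
prodQ-map-cong [] e = refl
prodQ-map-cong (x ∷ xs) e = cong₂ _*q_ (e x) (prodQ-map-cong xs e)

prodQ-zero : ∀ {A : Set} (f : A → ℚ) xs x ys → f x ≡ 0ℚ → prodQ (map f (xs ++ x ∷ ys)) ≡ 0ℚ
prodQ-zero f [] x ys fx≡0 = trans (cong (_*q prodQ (map f ys)) fx≡0) (ℚP.*-zeroˡ (prodQ (map f ys)))
prodQ-zero f (x′ ∷ xs) x ys fx≡0 = trans (cong (f x′ *q_) (prodQ-zero f xs x ys fx≡0)) (ℚP.*-zeroʳ (f x′))

rank-++ : ∀ w z → rank (w ++ z) ≡ rank w + rank z
rank-++ [] z = refl
rank-++ (d1 ∷ w) z = cong suc (rank-++ w z)
rank-++ (d2 ∷ w) z = cong (λ x → suc (suc x)) (rank-++ w z)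

rank-ones : ∀ m → rank (ones m) ≡ m
rank-ones zero = refl
rank-ones (suc m) = cong suc (rank-ones m)

positionsDesc-++ : ∀ w z → positionsDesc (w ++ z) ≡ map (_+ rank z) (positionsDesc w) ++ positionsDesc z
positionsDesc-++ [] z = refl
positionsDesc-++ (d1 ∷ w) z = positionsDesc-++ w z
positionsDesc-++ (d2 ∷ w) z = cong₂ _∷_ (cong suc (rank-++ w z)) (positionsDesc-++ w z)

positions-++ : ∀ w z → positions (w ++ z) ≡ positions z ++ map (_+ rank z) (positions w)
positions-++ w z = begin
  reverse (positionsDesc (w ++ z))
    ≡⟨ cong reverse (positionsDesc-++ w z) ⟩
  reverse (map (_+ rank z) (positionsDesc w) ++ positionsDesc z)
    ≡⟨ reverse-++ (map (_+ rank z) (positionsDesc w)) (positionsDesc z) ⟩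
  positions z ++ reverse (map (_+ rank z) (positionsDesc w))
    ≡⟨ cong (positions z ++_) (sym (reverse-map (_+ rank z) (positionsDesc w))) ⟩
  positions z ++ map (_+ rank z) (positions w) ∎
  where open ≡-Reasoning

positions-ones : ∀ m → positions (ones m) ≡ []
positions-ones zero = refl
positions-ones (suc m) = positions-ones m

positions-2∷ : ∀ z → positions (d2 ∷ z) ≡ positions z ++ suc (rank z) ∷ []
positions-2∷ z = unfold-reverse (suc (rank z)) (positionsDesc z)

All-reverse : ∀ {Q : ℕ → Set} xs → All Q xs → All Q (reverse xs)
All-reverse [] [] = []
All-reverse {Q} (x ∷ xs) (qx ∷ qxs) = subst (All Q) (sym (unfold-reverse x xs)) (AllP.++⁺ (All-reverse xs qxs) (qx ∷ []))

positions-bounded : ∀ w → All (_< rank w) (positions w)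
positions-bounded w = All-reverse (positionsDesc w) (bounded w)
  where
  bounded : ∀ w → All (_< rank w) (positionsDesc w)
  bounded [] = []
  bounded (d1 ∷ w) = All.map ℕP.m<n⇒m<1+n (bounded w)
  bounded (d2 ∷ w) = ℕP.n<1+n (suc (rank w)) ∷ All.map (λ h → ℕP.m<n⇒m<1+n (ℕP.m<n⇒m<1+n h)) (bounded w)

positions-positive : ∀ w → All (1 ≤_) (positions w)
positions-positive w = All-reverse (positionsDesc w) (positive w)
  where
  positive : ∀ w → All (1 ≤_) (positionsDesc w)
  positive [] = []
  positive (d1 ∷ w) = positive w
  positive (d2 ∷ w) = s≤s z≤n ∷ positive w

positionProduct≡ : ∀ z → positionProduct z ≡ prodQ (map ℕtoℚ (positions z))
positionProduct≡ [] = refl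
positionProduct≡ (d1 ∷ z) = positionProduct≡ z
positionProduct≡ (d2 ∷ z) = begin
  ℕtoℚ (suc (rank z)) *q positionProduct z
    ≡⟨ cong (ℕtoℚ (suc (rank z)) *q_) (positionProduct≡ z) ⟩
  ℕtoℚ (suc (rank z)) *q prodQ (map ℕtoℚ (positions z))
    ≡⟨ solve 2 (λ a b → a :* b := b :* (a :* con 1ℚ)) refl (ℕtoℚ (suc (rank z))) (prodQ (map ℕtoℚ (positions z))) ⟩
  prodQ (map ℕtoℚ (positions z)) *q prodQ (map ℕtoℚ (suc (rank z) ∷ []))
    ≡⟨ sym (prodQ-++ (map ℕtoℚ (positions z)) (map ℕtoℚ (suc (rank z) ∷ []))) ⟩
  prodQ (map ℕtoℚ (positions z) ++ map ℕtoℚ (suc (rank z) ∷ []))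
    ≡⟨ cong prodQ (sym (map-++ ℕtoℚ (positions z) (suc (rank z) ∷ []))) ⟩
  prodQ (map ℕtoℚ (positions z ++ suc (rank z) ∷ []))
    ≡⟨ cong (λ l → prodQ (map ℕtoℚ l)) (sym (positions-2∷ z)) ⟩
  prodQ (map ℕtoℚ (positions (d2 ∷ z))) ∎
  where open ≡-Reasoning

positions-++-2∷ones : ∀ u k → positions (u ++ d2 ∷ ones k) ≡ suc k ∷ map (_+ suc (suc k)) (positions u)
positions-++-2∷ones u k = begin
  positions (u ++ d2 ∷ ones k)
    ≡⟨ positions-++ u (d2 ∷ ones k) ⟩
  positions (d2 ∷ ones k) ++ map (_+ suc (suc (rank (ones k)))) (positions u)
    ≡⟨ cong₂ (λ l r → l ++ map (_+ suc (suc r)) (positions u))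
             (trans (positions-2∷ (ones k)) (cong₂ (λ l x → l ++ suc x ∷ []) (positions-ones k) (rank-ones k)))
             (rank-ones k) ⟩
  suc k ∷ map (_+ suc (suc k)) (positions u) ∎
  where open ≡-Reasoning

belowFirst-shift : ∀ K δs d → belowFirst (map (_+ K) δs) (d + K) ≡ belowFirst δs d
belowFirst-shift K [] d = refl
belowFirst-shift K (δ ∷ δs) d = <ᵇ-+ʳ d δ K

belowFirst-small : ∀ K δs d → d < K → belowFirst (map (_+ K) δs) d ≡ true
belowFirst-small K [] d d<K = refl
belowFirst-small K (δ ∷ δs) d d<K = <ᵇ-true (ℕP.<-≤-trans d<K (ℕP.m≤n+m K δ))

ℕtoℚ-+-cancelʳ : ∀ d δ K → ℕtoℚ (d + K) -q ℕtoℚ (δ + K) ≡ ℕtoℚ d -q ℕtoℚ δ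
ℕtoℚ-+-cancelʳ d δ K rewrite ℕtoℚ-+ d K | ℕtoℚ-+ δ K =
  solve 3 (λ a b c → (a :+ c) :+ (:- (b :+ c)) := a :+ (:- b)) refl (ℕtoℚ d) (ℕtoℚ δ) (ℕtoℚ K)

intervalFactor : ℕ → List ℕ → List ℕ → ℚ
intervalFactor δ δs ds = prodQ (map (λ d → ℕtoℚ d -q ℕtoℚ (suc δ)) (filterᵇ (λ d → (δ ≤ᵇ d) ∧ belowFirst δs d) ds))

intervalFactor-shift : ∀ K δ δs small ds → All (_< K) small →
  intervalFactor (δ + K) (map (_+ K) δs) (small ++ map (_+ K) ds) ≡ intervalFactor δ δs ds
intervalFactor-shift K δ δs small ds small<K = begin
  prodQ (map value (filterᵇ inInterval (small ++ map (_+ K) ds)))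
    ≡⟨ cong (λ l → prodQ (map value l)) (filterᵇ-++ inInterval small (map (_+ K) ds)) ⟩
  prodQ (map value (filterᵇ inInterval small ++ filterᵇ inInterval (map (_+ K) ds)))
    ≡⟨ cong (λ l → prodQ (map value (l ++ filterᵇ inInterval (map (_+ K) ds))))
            (filterᵇ-none inInterval small (All.map too-small small<K)) ⟩
  prodQ (map value (filterᵇ inInterval (map (_+ K) ds)))
    ≡⟨ cong (λ l → prodQ (map value l)) (filterᵇ-map inInterval (_+ K) ds) ⟩
  prodQ (map value (map (_+ K) (filterᵇ (λ d → inInterval (d + K)) ds)))
    ≡⟨ cong (λ l → prodQ (map value (map (_+ K) l)))
            (filterᵇ-cong ds (All.tabulate (λ {d} _ → cong₂ _∧_ (≤ᵇ-+ʳ δ d K) (belowFirst-shift K δs d)))) ⟩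
  prodQ (map value (map (_+ K) (filterᵇ (λ d → (δ ≤ᵇ d) ∧ belowFirst δs d) ds)))
    ≡⟨ cong prodQ (sym (map-∘ (filterᵇ (λ d → (δ ≤ᵇ d) ∧ belowFirst δs d) ds))) ⟩
  prodQ (map (λ d → ℕtoℚ (d + K) -q ℕtoℚ (suc δ + K)) (filterᵇ (λ d → (δ ≤ᵇ d) ∧ belowFirst δs d) ds))
    ≡⟨ prodQ-map-cong (filterᵇ (λ d → (δ ≤ᵇ d) ∧ belowFirst δs d) ds) (λ d → ℕtoℚ-+-cancelʳ d (suc δ) K) ⟩
  intervalFactor δ δs ds ∎
  where
  open ≡-Reasoning
  value = λ d → ℕtoℚ d -q ℕtoℚ (suc (δ + K))
  inInterval = λ d → (δ + K ≤ᵇ d) ∧ belowFirst (map (_+ K) δs) d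
  too-small : ∀ {d} → d < K → inInterval d ≡ false
  too-small {d} d<K = cong (_∧ belowFirst (map (_+ K) δs) d) (≤ᵇ-false (ℕP.<-≤-trans d<K (ℕP.m≤n+m K δ)))

intervalProd-shift : ∀ K δs small ds → All (_< K) small → intervalProd (map (_+ K) δs) (small ++ map (_+ K) ds) ≡ intervalProd δs ds
intervalProd-shift K [] small ds small<K = refl
intervalProd-shift K (δ ∷ δs) small ds small<K =
  cong₂ _*q_ (intervalFactor-shift K δ δs small ds small<K) (intervalProd-shift K δs small ds small<K)

belowFirstProduct : List ℕ → List ℕ → ℚ
belowFirstProduct δs ds = prodQ (map ℕtoℚ (filterᵇ (belowFirst δs) ds))

coeffFormula-ones : ∀ m v → coeffFormula (ones m) v ≡ positionProduct v
coeffFormula-ones m v = begin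
  coeffFormula (ones m) v
    ≡⟨ cong (λ δs → belowFirstProduct δs (positions v) *q intervalProd δs (positions v)) (positions-ones m) ⟩
  belowFirstProduct [] (positions v) *q 1ℚ
    ≡⟨ ℚP.*-identityʳ _ ⟩
  prodQ (map ℕtoℚ (filterᵇ (λ _ → true) (positions v)))
    ≡⟨ cong (λ l → prodQ (map ℕtoℚ l)) (filterᵇ-all (λ _ → true) (positions v) (All.tabulate (λ _ → refl))) ⟩
  prodQ (map ℕtoℚ (positions v))
    ≡⟨ sym (positionProduct≡ v) ⟩
  positionProduct v ∎
  where open ≡-Reasoning

-- What the positions ps of a word of rank k + 2 contribute to the formula when the first 2
-- of the other word sits at position k + 1.
pfacCoefficientFormula : ℕ → List ℕ → ℚ
pfacCoefficientFormula k ps =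
  prodQ (map ℕtoℚ (filterᵇ (_<ᵇ suc k) ps)) *q prodQ (map (λ d → ℕtoℚ d -q ℕtoℚ (suc (suc k))) (filterᵇ (suc k ≤ᵇ_) ps))

pfacCoefficient≡ : ∀ k z → rank z ≡ suc (suc k) → pfacCoefficient z ≡ pfacCoefficientFormula k (positions z)
pfacCoefficient≡ k (d1 ∷ z) rank≡ = begin
  positionProduct z
    ≡⟨ trans (positionProduct≡ z) (sym (ℚP.*-identityʳ _)) ⟩
  prodQ (map ℕtoℚ (positions z)) *q 1ℚ
    ≡⟨ cong₂ (λ a b → prodQ (map ℕtoℚ a) *q prodQ (map (λ d → ℕtoℚ d -q ℕtoℚ (suc (suc k))) b))
             (sym (filterᵇ-all (_<ᵇ suc k) (positions z) (All.map <ᵇ-true z<)))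
             (sym (filterᵇ-none (suc k ≤ᵇ_) (positions z) (All.map ≤ᵇ-false z<))) ⟩
  pfacCoefficientFormula k (positions z) ∎
  where
  open ≡-Reasoning
  z< : All (_< suc k) (positions z)
  z< = subst (λ r → All (_< r) (positions z)) (ℕP.suc-injective rank≡) (positions-bounded z)
pfacCoefficient≡ k (d2 ∷ z) rank≡ = begin
  -q positionProduct z
    ≡⟨ cong -q_ (positionProduct≡ z) ⟩
  -q prodQ (map ℕtoℚ (positions z))
    ≡⟨ minus-one-factor ⟩
  prodQ (map ℕtoℚ (positions z ++ [])) *q prodQ (map (λ d → ℕtoℚ d -q ℕtoℚ (suc (suc k))) ([] ++ suc k ∷ []))
    ≡⟨ cong₂ (λ a b → prodQ (map ℕtoℚ a) *q prodQ (map (λ d → ℕtoℚ d -q ℕtoℚ (suc (suc k))) b)) (sym below) (sym above) ⟩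
  pfacCoefficientFormula k (positions z ++ suc k ∷ [])
    ≡⟨ cong (pfacCoefficientFormula k) (sym (trans (positions-2∷ z) (cong (λ x → positions z ++ suc x ∷ []) rank≡′))) ⟩
  pfacCoefficientFormula k (positions (d2 ∷ z)) ∎
  where
  open ≡-Reasoning
  rank≡′ : rank z ≡ k
  rank≡′ = ℕP.suc-injective (ℕP.suc-injective rank≡)
  z< : All (_< k) (positions z)
  z< = subst (λ r → All (_< r) (positions z)) rank≡′ (positions-bounded z)
  below : filterᵇ (_<ᵇ suc k) (positions z ++ suc k ∷ []) ≡ positions z ++ []
  below = trans (filterᵇ-++ (_<ᵇ suc k) (positions z) (suc k ∷ []))
                (cong₂ _++_ (filterᵇ-all (_<ᵇ suc k) (positions z) (All.map (λ d<k → <ᵇ-true (ℕP.m<n⇒m<1+n d<k)) z<))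
                            (filterᵇ-none (_<ᵇ suc k) (suc k ∷ []) (<ᵇ-false {suc k} {suc k} ℕP.≤-refl ∷ [])))
  above : filterᵇ (suc k ≤ᵇ_) (positions z ++ suc k ∷ []) ≡ [] ++ suc k ∷ []
  above = trans (filterᵇ-++ (suc k ≤ᵇ_) (positions z) (suc k ∷ []))
                (cong₂ _++_ (filterᵇ-none (suc k ≤ᵇ_) (positions z) (All.map (λ d<k → ≤ᵇ-false (ℕP.m<n⇒m<1+n d<k)) z<))
                            (filterᵇ-all (suc k ≤ᵇ_) (suc k ∷ []) (≤ᵇ-true {suc k} {suc k} ℕP.≤-refl ∷ [])))
  minus-one-factor : -q prodQ (map ℕtoℚ (positions z)) ≡
    prodQ (map ℕtoℚ (positions z ++ [])) *q prodQ (map (λ d → ℕtoℚ d -q ℕtoℚ (suc (suc k))) ([] ++ suc k ∷ []))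
  minus-one-factor rewrite ++-identityʳ (positions z) | ℕtoℚ-suc (suc k) =
    solve 2 (λ a x → :- a := a :* ((x :+ (:- (x :+ con 1ℚ))) :* con 1ℚ)) refl (prodQ (map ℕtoℚ (positions z))) (ℕtoℚ (suc k))

module _ (k : ℕ) (δs ds : List ℕ) {ps : List ℕ} (ps<K : All (_< suc (suc k)) ps) where

  private
    K : ℕ
    K = suc (suc k)
    S L : List ℕ
    S = map (_+ K) δs
    L = ps ++ map (_+ K) ds
    k+1≤ : ∀ d → suc k ≤ d + K
    k+1≤ d = ℕP.≤-trans (ℕP.n≤1+n (suc k)) (ℕP.m≤n+m K d)

  belowFirstProduct-shift : belowFirstProduct (suc k ∷ S) L ≡ prodQ (map ℕtoℚ (filterᵇ (_<ᵇ suc k) ps))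
  belowFirstProduct-shift = cong (λ l → prodQ (map ℕtoℚ l)) (begin
    filterᵇ (_<ᵇ suc k) L
      ≡⟨ filterᵇ-++ (_<ᵇ suc k) ps (map (_+ K) ds) ⟩
    filterᵇ (_<ᵇ suc k) ps ++ filterᵇ (_<ᵇ suc k) (map (_+ K) ds)
      ≡⟨ cong (filterᵇ (_<ᵇ suc k) ps ++_)
              (trans (filterᵇ-map (_<ᵇ suc k) (_+ K) ds)
                     (cong (map (_+ K)) (filterᵇ-none (λ d → d + K <ᵇ suc k) ds (All.tabulate (λ {d} _ → <ᵇ-false (k+1≤ d)))))) ⟩
    filterᵇ (_<ᵇ suc k) ps ++ []
      ≡⟨ ++-identityʳ _ ⟩
    filterᵇ (_<ᵇ suc k) ps ∎)
    where open ≡-Reasoning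

  intervalFactor-shift-first : intervalFactor (suc k) S L ≡
    prodQ (map (λ d → ℕtoℚ d -q ℕtoℚ K) (filterᵇ (suc k ≤ᵇ_) ps)) *q belowFirstProduct δs ds
  intervalFactor-shift-first = begin
    prodQ (map value (filterᵇ inInterval (ps ++ map (_+ K) ds)))
      ≡⟨ cong (λ l → prodQ (map value l)) (filterᵇ-++ inInterval ps (map (_+ K) ds)) ⟩
    prodQ (map value (filterᵇ inInterval ps ++ filterᵇ inInterval (map (_+ K) ds)))
      ≡⟨ cong₂ (λ a b → prodQ (map value (a ++ b)))
               (filterᵇ-cong ps (All.map (λ {d} d<K → trans (cong ((suc k ≤ᵇ d) ∧_) (belowFirst-small K δs d d<K))
                                                            (∧-identityʳ (suc k ≤ᵇ d))) ps<K))
               (trans (filterᵇ-map inInterval (_+ K) ds)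
                      (cong (map (_+ K)) (filterᵇ-cong ds (All.tabulate (λ {d} _ → cong₂ _∧_ (≤ᵇ-true (k+1≤ d)) (belowFirst-shift K δs d)))))) ⟩
    prodQ (map value (filterᵇ (suc k ≤ᵇ_) ps ++ map (_+ K) (filterᵇ (belowFirst δs) ds)))
      ≡⟨ trans (cong prodQ (map-++ value (filterᵇ (suc k ≤ᵇ_) ps) _)) (prodQ-++ (map value (filterᵇ (suc k ≤ᵇ_) ps)) _) ⟩
    prodQ (map value (filterᵇ (suc k ≤ᵇ_) ps)) *q prodQ (map value (map (_+ K) (filterᵇ (belowFirst δs) ds)))
      ≡⟨ cong (prodQ (map value (filterᵇ (suc k ≤ᵇ_) ps)) *q_)
              (trans (cong prodQ (sym (map-∘ (filterᵇ (belowFirst δs) ds)))) (prodQ-map-cong (filterᵇ (belowFirst δs) ds) unshift)) ⟩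
    prodQ (map value (filterᵇ (suc k ≤ᵇ_) ps)) *q belowFirstProduct δs ds ∎
    where
    open ≡-Reasoning
    value = λ d → ℕtoℚ d -q ℕtoℚ K
    inInterval = λ d → (suc k ≤ᵇ d) ∧ belowFirst S d
    unshift : ∀ d → ℕtoℚ (d + K) -q ℕtoℚ K ≡ ℕtoℚ d
    unshift d = trans (cong (_-q ℕtoℚ K) (ℕtoℚ-+ d K)) (solve 2 (λ a b → (a :+ b) :+ (:- b) := a) refl (ℕtoℚ d) (ℕtoℚ K))

coeffFormula-++ : ∀ u k v z → rank z ≡ suc (suc k) →
  coeffFormula (u ++ d2 ∷ ones k) (v ++ z) ≡ coeffFormula u v *q pfacCoefficient z
coeffFormula-++ u k v z rank≡ = begin
  coeffFormula (u ++ d2 ∷ ones k) (v ++ z)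
    ≡⟨ cong₂ (λ δs ds → belowFirstProduct δs ds *q intervalProd δs ds) (positions-++-2∷ones u k) positions-v++z ⟩
  belowFirstProduct (suc k ∷ S) L *q (intervalFactor (suc k) S L *q intervalProd S L)
    ≡⟨ cong₂ _*q_ (belowFirstProduct-shift k δs ds z<K)
                  (cong₂ _*q_ (intervalFactor-shift-first k δs ds z<K) (intervalProd-shift K δs (positions z) ds z<K)) ⟩
  A *q ((B *q C) *q intervalProd δs ds)
    ≡⟨ solve 4 (λ a b c i → a :* ((b :* c) :* i) := (c :* i) :* (a :* b)) refl A B C (intervalProd δs ds) ⟩
  (C *q intervalProd δs ds) *q (A *q B)
    ≡⟨ cong (coeffFormula u v *q_) (sym (pfacCoefficient≡ k z rank≡)) ⟩
  coeffFormula u v *q pfacCoefficient z ∎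
  where
  open ≡-Reasoning
  K = suc (suc k)
  δs = positions u
  ds = positions v
  S = map (_+ K) δs
  L = positions z ++ map (_+ K) ds
  A = prodQ (map ℕtoℚ (filterᵇ (_<ᵇ suc k) (positions z)))
  B = prodQ (map (λ d → ℕtoℚ d -q ℕtoℚ K) (filterᵇ (suc k ≤ᵇ_) (positions z)))
  C = belowFirstProduct δs ds
  positions-v++z : positions (v ++ z) ≡ L
  positions-v++z = trans (positions-++ v z) (cong (λ r → positions z ++ map (_+ r) ds) rank≡)
  z<K : All (_< K) (positions z)
  z<K = subst (λ r → All (_< r) (positions z)) rank≡ (positions-bounded z)

-- The 2 ending at the junction sits at position k + 2 = δ₁ + 1, making a factor of
-- intervalProd vanish.
coeffFormula-straddling : ∀ u k v z → rank z ≡ suc k → coeffFormula (u ++ d2 ∷ ones k) (v ++ d2 ∷ z) ≡ 0ℚ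
coeffFormula-straddling u k v z rank≡ = begin
  coeffFormula (u ++ d2 ∷ ones k) (v ++ d2 ∷ z)
    ≡⟨ cong₂ (λ δs ds → belowFirstProduct δs ds *q intervalProd δs ds) (positions-++-2∷ones u k) positions-v++2z ⟩
  belowFirstProduct (suc k ∷ S) L *q (intervalFactor (suc k) S L *q intervalProd S L)
    ≡⟨ cong (λ t → belowFirstProduct (suc k ∷ S) L *q (t *q intervalProd S L)) vanishing-factor ⟩
  belowFirstProduct (suc k ∷ S) L *q (0ℚ *q intervalProd S L)
    ≡⟨ trans (cong (belowFirstProduct (suc k ∷ S) L *q_) (ℚP.*-zeroˡ (intervalProd S L))) (ℚP.*-zeroʳ (belowFirstProduct (suc k ∷ S) L)) ⟩
  0ℚ ∎
  where
  open ≡-Reasoning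
  K = suc (suc k)
  S = map (_+ K) (positions u)
  R = map (_+ suc (suc (rank z))) (positions v)
  L = (positions z ++ K ∷ []) ++ R
  inInterval = λ d → (suc k ≤ᵇ d) ∧ belowFirst S d
  positions-v++2z : positions (v ++ d2 ∷ z) ≡ L
  positions-v++2z = trans (positions-++ v (d2 ∷ z)) (cong (_++ R) (trans (positions-2∷ z) (cong (λ x → positions z ++ suc x ∷ []) rank≡)))
  K-inInterval : inInterval K ≡ true
  K-inInterval = cong₂ _∧_ (≤ᵇ-true (ℕP.n≤1+n (suc k))) (below-S (positions u) (positions-positive u))
    where
    below-S : ∀ δs → All (1 ≤_) δs → belowFirst (map (_+ K) δs) K ≡ true
    below-S [] _ = refl
    below-S (δ ∷ δs) (1≤δ ∷ _) = <ᵇ-true (ℕP.+-monoˡ-≤ K {1} {δ} 1≤δ)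
  vanishing-factor : intervalFactor (suc k) S L ≡ 0ℚ
  vanishing-factor = begin
    prodQ (map value (filterᵇ inInterval L))
      ≡⟨ cong (λ l → prodQ (map value l)) filter-L ⟩
    prodQ (map value (filterᵇ inInterval (positions z) ++ K ∷ filterᵇ inInterval R))
      ≡⟨ prodQ-zero value (filterᵇ inInterval (positions z)) K (filterᵇ inInterval R) (ℚP.+-inverseʳ (ℕtoℚ K)) ⟩
    0ℚ ∎
    where
    value = λ d → ℕtoℚ d -q ℕtoℚ K
    filter-L : filterᵇ inInterval L ≡ filterᵇ inInterval (positions z) ++ K ∷ filterᵇ inInterval R
    filter-L = begin
      filterᵇ inInterval ((positions z ++ K ∷ []) ++ R)
        ≡⟨ filterᵇ-++ inInterval (positions z ++ K ∷ []) R ⟩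
      filterᵇ inInterval (positions z ++ K ∷ []) ++ filterᵇ inInterval R
        ≡⟨ cong (_++ filterᵇ inInterval R) (filterᵇ-++ inInterval (positions z) (K ∷ [])) ⟩
      (filterᵇ inInterval (positions z) ++ filterᵇ inInterval (K ∷ [])) ++ filterᵇ inInterval R
        ≡⟨ cong (λ l → (filterᵇ inInterval (positions z) ++ l) ++ filterᵇ inInterval R)
                (filterᵇ-all inInterval (K ∷ []) (K-inInterval ∷ [])) ⟩
      (filterᵇ inInterval (positions z) ++ K ∷ []) ++ filterᵇ inInterval R
        ≡⟨ ++-assoc (filterᵇ inInterval (positions z)) (K ∷ []) (filterᵇ inInterval R) ⟩
      filterᵇ inInterval (positions z) ++ K ∷ filterᵇ inInterval R ∎

YFpred : ℕ → List FWord
YFpred zero = []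
YFpred (suc n) = YF n

∑-YF-suc : ∀ N (g : FWord → Poly) → ∑ g (YF (suc N)) ≋ ∑ (λ v → g (d1 ∷ v)) (YF N) ⊕ ∑ (λ v → g (d2 ∷ v)) (YFpred N)
∑-YF-suc zero g = ≋-sym (⊕-identityʳ _)
∑-YF-suc (suc N) g = ∑-YF N g

-- The words v 2 z of rank N + k + 2 with |z| = k + 1.
straddling : ℕ → ℕ → (FWord → Poly) → Poly
straddling N k f = ∑ (λ v → ∑ (λ z → f (v ++ d2 ∷ z)) (YF (suc k))) (YFpred N)

∑-YF-+ : ∀ N k (f : FWord → Poly) →
  ∑ f (YF (N + suc (suc k))) ≋ ∑ (λ v → ∑ (λ z → f (v ++ z)) (YF (suc (suc k)))) (YF N) ⊕ straddling N k f
∑-YF-+ zero k f = ≋-sym (≋-trans (⊕-identityʳ _) (⊕-identityʳ _))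
∑-YF-+ (suc zero) k f =
  ≋-trans (∑-YF (suc k) f)
          (≋-sym (⊕-cong (⊕-identityʳ (∑ (λ z → f (d1 ∷ z)) (YF (suc (suc k))))) (⊕-identityʳ (∑ (λ z → f (d2 ∷ z)) (YF (suc k))))))
∑-YF-+ (suc (suc N)) k f = begin
  ∑ f (YF (suc (suc (N + K))))
    ≈⟨ ∑-YF (N + K) f ⟩
  ∑ f₁ (YF (suc N + K)) ⊕ ∑ f₂ (YF (N + K))
    ≈⟨ ⊕-cong (∑-YF-+ (suc N) k f₁) (∑-YF-+ N k f₂) ⟩
  (∑ (λ v → G (d1 ∷ v)) (YF (suc N)) ⊕ straddling (suc N) k f₁) ⊕ (∑ (λ v → G (d2 ∷ v)) (YF N) ⊕ straddling N k f₂)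
    ≈⟨ ⊕-interchange (∑ (λ v → G (d1 ∷ v)) (YF (suc N))) (straddling (suc N) k f₁) (∑ (λ v → G (d2 ∷ v)) (YF N)) (straddling N k f₂) ⟩
  (∑ (λ v → G (d1 ∷ v)) (YF (suc N)) ⊕ ∑ (λ v → G (d2 ∷ v)) (YF N)) ⊕ (straddling (suc N) k f₁ ⊕ straddling N k f₂)
    ≈⟨ ⊕-cong (≋-sym (∑-YF N G)) (≋-sym (∑-YF-suc N (λ v → ∑ (λ z → f (v ++ d2 ∷ z)) (YF (suc k))))) ⟩
  ∑ G (YF (suc (suc N))) ⊕ straddling (suc (suc N)) k f ∎
  where
  open ≋-Reasoning
  K = suc (suc k)
  G = λ v → ∑ (λ z → f (v ++ z)) (YF K)
  f₁ f₂ : FWord → Poly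
  f₁ w = f (d1 ∷ w)
  f₂ w = f (d2 ∷ w)

data SuffixView : FWord → Set where
  only-ones : ∀ m → SuffixView (ones m)
  then-2-ones : ∀ u k → SuffixView u → SuffixView (u ++ d2 ∷ ones k)

suffixView-1∷ : ∀ {u} → SuffixView u → SuffixView (d1 ∷ u)
suffixView-1∷ (only-ones m) = only-ones (suc m)
suffixView-1∷ (then-2-ones u k V) = then-2-ones (d1 ∷ u) k (suffixView-1∷ V)

suffixView-2∷ : ∀ {u} → SuffixView u → SuffixView (d2 ∷ u)
suffixView-2∷ (only-ones m) = then-2-ones [] m (only-ones 0)
suffixView-2∷ (then-2-ones u k V) = then-2-ones (d2 ∷ u) k (suffixView-2∷ V)

suffixView : ∀ u → SuffixView u
suffixView [] = only-ones 0
suffixView (d1 ∷ u) = suffixView-1∷ (suffixView u)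
suffixView (d2 ∷ u) = suffixView-2∷ (suffixView u)

expansion : FWord → Poly
expansion u = ∑ (λ v → coeffFormula u v · s v) (YF (rank u))

expansion-ones : ∀ m → X ^ m ≋ expansion (ones m)
expansion-ones m = begin
  X ^ m
    ≈⟨ X^≋∑ m ⟩
  ∑ (λ v → positionProduct v · s v) (YF m)
    ≈⟨ ∑-cong (λ v → ≡⇒≋ (cong (_· s v) (sym (coeffFormula-ones m v)))) (YF m) ⟩
  ∑ (λ v → coeffFormula (ones m) v · s v) (YF m)
    ≡⟨ cong (λ n → ∑ (λ v → coeffFormula (ones m) v · s v) (YF n)) (sym (rank-ones m)) ⟩
  expansion (ones m) ∎
  where open ≋-Reasoning

pfac-⊗-expansion : ∀ u k → pfac k ⊗ expansion u ≋ expansion (u ++ d2 ∷ ones k)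
pfac-⊗-expansion u k = begin
  pfac k ⊗ ∑ (λ v → coeffFormula u v · s v) (YF N)
    ≈⟨ ≋-sym (∑-⊗ˡ (pfac k) (λ v → coeffFormula u v · s v) (YF N)) ⟩
  ∑ (λ v → pfac k ⊗ (coeffFormula u v · s v)) (YF N)
    ≈⟨ ∑-cong (λ v → ≋-trans (·-⊗ʳ (coeffFormula u v) (pfac k) (s v)) (·-cong (coeffFormula u v) (pfac-⊗-s k v))) (YF N) ⟩
  ∑ (λ v → coeffFormula u v · ∑ (λ z → pfacCoefficient z · s (v ++ z)) (YF K)) (YF N)
    ≈⟨ ∑-cong (λ v → ≋-trans (≋-sym (∑-· (coeffFormula u v) (λ z → pfacCoefficient z · s (v ++ z)) (YF K)))
                             (∑-cong (λ z → ·-assoc (coeffFormula u v) (pfacCoefficient z) (s (v ++ z))) (YF K))) (YF N) ⟩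
  ∑ (λ v → ∑ (λ z → (coeffFormula u v *q pfacCoefficient z) · s (v ++ z)) (YF K)) (YF N)
    ≈⟨ ∑-cong (λ v → ∑-cong-All (λ z rank≡ → ≡⇒≋ (cong (_· s (v ++ z)) (sym (coeffFormula-++ u k v z rank≡)))) (YF-rank K)) (YF N) ⟩
  ∑ (λ v → ∑ (λ z → F (v ++ z)) (YF K)) (YF N)
    ≈⟨ ≋-sym (≋-trans (⊕-congʳ _ straddling-vanishes) (⊕-identityʳ _)) ⟩
  ∑ (λ v → ∑ (λ z → F (v ++ z)) (YF K)) (YF N) ⊕ straddling N k F
    ≈⟨ ≋-sym (∑-YF-+ N k F) ⟩
  ∑ F (YF (N + K))
    ≡⟨ cong (λ n → ∑ F (YF n)) (sym rank≡) ⟩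
  expansion (u ++ d2 ∷ ones k) ∎
  where
  open ≋-Reasoning
  N = rank u
  K = suc (suc k)
  F = λ v → coeffFormula (u ++ d2 ∷ ones k) v · s v
  rank≡ : rank (u ++ d2 ∷ ones k) ≡ N + K
  rank≡ = trans (rank-++ u (d2 ∷ ones k)) (cong (λ x → N + suc (suc x)) (rank-ones k))
  straddling-vanishes : straddling N k F ≋ 𝟘
  straddling-vanishes = ∑-zero (λ v → ∑-zero-All v) (YFpred N)
    where
    ∑-zero-All : ∀ v → ∑ (λ z → F (v ++ d2 ∷ z)) (YF (suc k)) ≋ 𝟘
    ∑-zero-All v = ≋-trans (∑-cong-All (λ z rank≡ → ≋-trans (≡⇒≋ (cong (_· s (v ++ d2 ∷ z)) (coeffFormula-straddling u k v z rank≡)))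
                                                             (·-zero (s (v ++ d2 ∷ z))))
                                       (YF-rank (suc k)))
                           (∑-zero (λ _ → ≋-refl) (YF (suc k)))

p≋expansion : ∀ u → SuffixView u → p u ≋ expansion u
p≋expansion .(ones m) (only-ones m) = ≋-trans (p-ones m) (expansion-ones m)
p≋expansion .(u ++ d2 ∷ ones k) (then-2-ones u k V) =
  ≋-trans (p-++-2∷ones u k) (≋-trans (⊗-congʳ (pfac k) (p≋expansion u V)) (pfac-⊗-expansion u k))

proposition6p2 : (n : ℕ) (u : FWord) → rank u ≡ n →
    p u ≈ sumP (map (λ v → coeffFormula u v · s v) (YF n))
proposition6p2 n u refl = un≋ (p≋expansion u (suffixView u))
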